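{- Let $u_{i_k}u_{i_{k-1}}\cdots u_{i_1}$ and $u_{j_l}u_{j_{l-1}}\cdots u_{j_1}$ be two monomials in the ribbon Schur operators (with $i_1,\dots,i_k,j_1,\dots,j_l\in\mathbb{Z}$). Suppose that for some $t\in\mathbb{Z}$ and some partition $\mu$ we have \[ u_{i_k}\cdots u_{i_1}\cdot \mu = q^t\, u_{j_l}\cdots u_{j_1}\cdot\mu \neq 0. \] Then $u_{i_k}\cdots u_{i_1} = q^t\, u_{j_l}\cdots u_{j_1}$ as operators on $\mathbf F$, and this equality can be deduced (in the free associative $K$-algebra on symbols $u_i$, $i\in\mathbb{Z}$) from the following relations alone: (R1) $u_iu_j=u_ju_i$ for $|i-j|\ge n+1$; (R2) $u_i^2=0$ for all $i$; (R3) $u_{i+n}u_iu_{i+n}=0$ for all $i$; (R4) $u_iu_{i+n}u_i=0$ for all $i$; (R5) $u_iu_j=q^2u_ju_i$ for $0<i-j<n$.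
   Context: Fix an integer $n\ge 1$. Partitions are drawn in English notation; the box in row $r$ and column $c$ lies on diagonal (content) $c-r$. An $n$-ribbon is a connected skew shape with $n$ boxes containing no $2\times 2$ square; its head is its top-right box, and its spin is its number of rows minus $1$. Let $K=\mathbb{C}(q)$ and let $\mathbf F$ be the $K$-vector space with basis the set of all partitions. For $i\in\mathbb{Z}$ the ribbon Schur operator $u_i\in\mathrm{End}_K(\mathbf F)$ is defined on basis elements by $u_i(\lambda)=q^{\mathrm{spin}(\mu/\lambda)}\mu$ if there is a partition $\mu\supseteq\lambda$ such that $\mu/\lambda$ is an $n$-ribbon whose head lies on diagonal $i$ (such $\mu$ is unique), and $u_i(\lambda)=0$ otherwise. The operators $u_i$ satisfy the relations (R1)–(R5). -}

module Defs where

open import Data.Nat as ℕ using (ℕ; zero; suc; _≤_; _<_; _<?_)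
open import Data.Integer as ℤ using (ℤ; +_; ∣_∣)
open import Data.List using (List; []; _∷_; _++_; length; filter; upTo)
open import Data.Nat.ListAction using (sum)
open import Data.List.Relation.Unary.All using (All)
open import Data.List.Relation.Unary.Linked using (Linked)
open import Data.Maybe using (Maybe; just; nothing)
open import Data.Product using (_×_; _,_; Σ; ∃)
open import Data.Sum using (_⊎_)
open import Relation.Nullary using (¬_)
open import Relation.Binary.PropositionalEquality using (_≡_)

-- Partitions (English notation), boxes are 0-indexed (row r, column c);
-- the content (diagonal) of box (r , c) is c - r (shifting both indices
-- by 1 does not change it).

IsPartition : List ℕ → Set
IsPartition λ′ = Linked ℕ._≥_ λ′ × All (λ x → 0 < x) λ′

rowLen : List ℕ → ℕ → ℕ
rowLen []       _       = 0
rowLen (x ∷ _)  zero    = x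
rowLen (_ ∷ xs) (suc r) = rowLen xs r

size : List ℕ → ℕ
size = sum

Box : Set
Box = ℕ × ℕ

content : Box → ℤ
content (r , c) = + c ℤ.- + r

_⊆Y_ : List ℕ → List ℕ → Set
λ′ ⊆Y μ = ∀ r → rowLen λ′ r ≤ rowLen μ r

InSkew : List ℕ → List ℕ → Box → Set
InSkew λ′ μ (r , c) = rowLen λ′ r ≤ c × c < rowLen μ r

Adj : Box → Box → Set
Adj (r , c) (r′ , c′) =
  (r′ ≡ r × (c′ ≡ suc c ⊎ c ≡ suc c′)) ⊎ (c′ ≡ c × (r′ ≡ suc r ⊎ r ≡ suc r′))

data Reach (λ′ μ : List ℕ) : Box → Box → Set where
  here : ∀ {a} → Reach λ′ μ a a
  step : ∀ {a b d} → Adj a b → InSkew λ′ μ b → Reach λ′ μ b d → Reach λ′ μ a d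

Connected : List ℕ → List ℕ → Set
Connected λ′ μ = ∀ a b → InSkew λ′ μ a → InSkew λ′ μ b → Reach λ′ μ a b

No2×2 : List ℕ → List ℕ → Set
No2×2 λ′ μ = ¬ (Σ ℕ λ r → Σ ℕ λ c →
  InSkew λ′ μ (r , c) × InSkew λ′ μ (r , suc c) ×
  InSkew λ′ μ (suc r , c) × InSkew λ′ μ (suc r , suc c))

IsHead : List ℕ → List ℕ → Box → Set
IsHead λ′ μ (r , c) = InSkew λ′ μ (r , c) ×
  (∀ r′ c′ → InSkew λ′ μ (r′ , c′) → r ≤ r′ × (r′ ≡ r → c′ ≤ c))

IsRibbonAdd : ℕ → List ℕ → List ℕ → ℤ → Set
IsRibbonAdd n λ′ μ i =
  IsPartition μ × λ′ ⊆Y μ × size μ ≡ size λ′ ℕ.+ n ×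
  Connected λ′ μ × No2×2 λ′ μ ×
  Σ Box (λ h → IsHead λ′ μ h × content h ≡ i)

spin : List ℕ → List ℕ → ℕ
spin λ′ μ = length (filter (λ r → rowLen λ′ r <? rowLen μ r) (upTo (length μ))) ℕ.∸ 1

-- Since every u_i sends a basis vector to
-- either 0 or q^s·(basis vector), a vector in the image of a monomial
-- applied to a basis vector is encoded as
--   nothing          ↦ 0
--   just (e , μ)     ↦ q^e · μ
Res : Set
Res = Maybe (ℤ × List ℕ)

scale : ℤ → Res → Res
scale t nothing        = nothing
scale t (just (e , μ)) = just (t ℤ.+ e , μ)

data U (n : ℕ) (i : ℤ) (λ′ : List ℕ) : Res → Set where
  hit  : ∀ μ → IsRibbonAdd n λ′ μ i → U n i λ′ (just (+ spin λ′ μ , μ))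
  miss : (∀ μ → ¬ IsRibbonAdd n λ′ μ i) → U n i λ′ nothing

data Apply (n : ℕ) (i : ℤ) : Res → Res → Set where
  app0 : Apply n i nothing nothing
  appj : ∀ {e λ′ x} → U n i λ′ x → Apply n i (just (e , λ′)) (scale e x)

-- A monomial u_{w_1} u_{w_2} ⋯ u_{w_k} is the list w = w_1 ∷ … ∷ w_k
-- (written left to right; the rightmost operator acts first).
-- Act n w x y : "(u_{w_1} ⋯ u_{w_k}) x = y"
data Act (n : ℕ) : List ℤ → Res → Res → Set where
  nil  : ∀ {x} → Act n [] x x
  cons : ∀ {i w x y z} → Act n w x y → Apply n i y z → Act n (i ∷ w) x z

-- equality of the two operators q^0·I and q^t·J on all of F
-- (it suffices to compare them on the basis of partitions)
OpEq : ℕ → List ℤ → ℤ → List ℤ → Set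
OpEq n I t J = ∀ λ′ → IsPartition λ′ → ∀ x y →
  Act n I (just (+ 0 , λ′)) x → Act n J (just (+ 0 , λ′)) y → x ≡ scale t y

-- Deduction from the relations (R1)-(R5) in the free algebra on the u_i:
-- elements of the form 0 or q^e·(monomial), identified by the congruence
-- generated by (R1)-(R5) (applied inside arbitrary left/right contexts).

data Mon : Set where
  zeroM : Mon
  sc    : ℤ → List ℤ → Mon

data Deriv (n : ℕ) : Mon → Mon → Set where
  drefl  : ∀ {x} → Deriv n x x
  dsym   : ∀ {x y} → Deriv n x y → Deriv n y x
  dtrans : ∀ {x y z} → Deriv n x y → Deriv n y z → Deriv n x z
  r1 : ∀ e a b i j → suc n ≤ ∣ i ℤ.- j ∣ →
       Deriv n (sc e (a ++ i ∷ j ∷ b)) (sc e (a ++ j ∷ i ∷ b))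
  r2 : ∀ e a b i → Deriv n (sc e (a ++ i ∷ i ∷ b)) zeroM
  r3 : ∀ e a b i →
       Deriv n (sc e (a ++ (i ℤ.+ + n) ∷ i ∷ (i ℤ.+ + n) ∷ b)) zeroM
  r4 : ∀ e a b i →
       Deriv n (sc e (a ++ i ∷ (i ℤ.+ + n) ∷ i ∷ b)) zeroM
  r5 : ∀ e a b i j → + 0 ℤ.< i ℤ.- j → i ℤ.- j ℤ.< + n →
       Deriv n (sc e (a ++ i ∷ j ∷ b)) (sc (e ℤ.+ + 2) (a ++ j ∷ i ∷ b))

{-# OPTIONS --safe #-}
module Submission where

-- Encode a partition by its β-numbers λ_r - r, i.e. by beads on a line.  Adding an n-ribbon
-- with head on diagonal i moves the bead at i + 1 - n to the empty position i + 1, and its spin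
-- is the number of beads jumped over; so u_i λ is nonzero exactly when this move is possible,
-- and it determines the result.  In this language (R1)-(R5) hold: moves at four distinct
-- positions commute, with spins differing by 2 exactly when 0 < i - j < n, and in (R2)-(R4)
-- the bead or the gap needed by the last move is missing.
--
-- Conversely, suppose u_I μ = q^t u_J μ ≠ 0 and u_a is applied last in I.  The number of beads
-- at a + 1, a + 1 + n, a + 1 + 2n, … is raised by u_a and preserved by every other u_c, so u_a
-- occurs in J; the operators applied after its last occurrence cannot touch the positions
-- of u_a and hence commute past it by (R1) and (R5).  Since u_a is injective on partitions, we
-- may cancel it and induct on the length of I.  Soundness of the relations then fixes the power
-- of q and yields the operator identity.

module _ where

  open import Defs
  open import Data.Nat as ℕ using (ℕ; zero; suc; z≤n; s≤s; _+_; _*_; _∸_; _≤_; _<_; _<?_; _≤?_)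
  import Data.Nat.Properties as ℕP
  open import Data.Nat.Divisibility using (_∣_; _∣?_; _∣0; ∣⇒≤; ∣m+n∣m⇒∣n; ∣m∸n∣n⇒∣m; n∣n)
  open import Data.Nat.Induction using (<-rec)
  open import Data.Integer as ℤ using (ℤ; +_; -[1+_]; -_; ∣_∣)
    renaming (_+_ to _+ᶻ_; _-_ to _-ᶻ_; _<_ to _<ᶻ_; _≤_ to _≤ᶻ_)
  import Data.Integer.Properties as ℤP
  open import Data.List using (List; []; _∷_; length; _++_; filter; applyUpTo; upTo)
  open import Data.List.Relation.Unary.All using (All; []; _∷_)
  open import Data.List.Relation.Unary.Linked using (Linked; []; [-]; _∷_)
  open import Data.Maybe using (just; nothing)
  open import Data.Maybe.Properties using (just-injective)
  open import Data.Product using (_×_; _,_; Σ; proj₁; proj₂)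
  open import Data.Sum using (_⊎_; inj₁; inj₂)
  open import Data.Unit using (⊤; tt)
  open import Data.Empty using (⊥; ⊥-elim)
  open import Relation.Nullary using (¬_; Dec; yes; no)
  open import Relation.Nullary.Decidable using (_×-dec_)
  open import Relation.Unary using (Pred; Decidable)
  open import Function using (_∘_)
  open import Relation.Binary.PropositionalEquality
  open import Relation.Binary.Definitions using (tri<; tri≈; tri>)
  import Data.Nat.Solver
  import Data.Integer.Solver

  module ℕ-Solver = Data.Nat.Solver.+-*-Solver
  module ℤ-Solver = Data.Integer.Solver.+-*-Solver

  sub+add≡add : ∀ a b d → (+ a -ᶻ + b) +ᶻ (+ b +ᶻ + d) ≡ + (a + d)
  sub+add≡add a b d = solve 3 (λ A B D → (A :- B) :+ (B :+ D) := A :+ D) refl (+ a) (+ b) (+ d)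
    where open ℤ-Solver

  sub≡sub⇒ : ∀ a b c d → + a -ᶻ + b ≡ + c -ᶻ + d → a + d ≡ c + b
  sub≡sub⇒ a b c d e = ℤP.+-injective (begin
    + (a + d)                    ≡⟨ sym (sub+add≡add a b d) ⟩
    (+ a -ᶻ + b) +ᶻ (+ b +ᶻ + d) ≡⟨ cong (_+ᶻ (+ b +ᶻ + d)) e ⟩
    (+ c -ᶻ + d) +ᶻ (+ b +ᶻ + d) ≡⟨ cong ((+ c -ᶻ + d) +ᶻ_) (ℤP.+-comm (+ b) (+ d)) ⟩
    (+ c -ᶻ + d) +ᶻ (+ d +ᶻ + b) ≡⟨ sub+add≡add c d b ⟩
    + (c + b)                    ∎)
    where open ≡-Reasoning

  sub≡sub⇐ : ∀ a b c d → a + d ≡ c + b → + a -ᶻ + b ≡ + c -ᶻ + d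
  sub≡sub⇐ a b c d e = begin
    + a -ᶻ + b                  ≡⟨ solve 3 (λ A B D → A :- B := (A :+ D) :- (B :+ D)) refl (+ a) (+ b) (+ d) ⟩
    + (a + d) -ᶻ (+ b +ᶻ + d) ≡⟨ cong (λ z → + z -ᶻ (+ b +ᶻ + d)) e ⟩
    + (c + b) -ᶻ (+ b +ᶻ + d) ≡⟨ solve 3 (λ C B D → (C :+ B) :- (B :+ D) := C :- D) refl (+ c) (+ b) (+ d) ⟩
    + c -ᶻ + d                  ∎
    where
    open ≡-Reasoning
    open ℤ-Solver

  sub<sub⇒ : ∀ a b c d → + a -ᶻ + b <ᶻ + c -ᶻ + d → a + d < c + b
  sub<sub⇒ a b c d lt = ℤP.drop‿+<+ (subst₂ _<ᶻ_ (sub+add≡add a b d) rhs (ℤP.+-monoˡ-< (+ b +ᶻ + d) lt))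
    where
    rhs : (+ c -ᶻ + d) +ᶻ (+ b +ᶻ + d) ≡ + (c + b)
    rhs = trans (cong ((+ c -ᶻ + d) +ᶻ_) (ℤP.+-comm (+ b) (+ d))) (sub+add≡add c d b)

  sub<sub⇐ : ∀ a b c d → a + d < c + b → + a -ᶻ + b <ᶻ + c -ᶻ + d
  sub<sub⇐ a b c d lt with ℤP.<-cmp (+ a -ᶻ + b) (+ c -ᶻ + d)
  ... | tri< x _ _ = x
  ... | tri≈ _ e _ = ⊥-elim (ℕP.<-irrefl (sub≡sub⇒ a b c d e) lt)
  ... | tri> _ _ g = ⊥-elim (ℕP.<-asym lt (sub<sub⇒ c d a b g))

  sub≤sub⇒ : ∀ a b c d → + a -ᶻ + b ≤ᶻ + c -ᶻ + d → a + d ≤ c + b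
  sub≤sub⇒ a b c d le = ℕP.≮⇒≥ (λ lt → ℤP.<-irrefl refl (ℤP.≤-<-trans le (sub<sub⇐ c d a b lt)))

  sub≤sub⇐ : ∀ a b c d → a + d ≤ c + b → + a -ᶻ + b ≤ᶻ + c -ᶻ + d
  sub≤sub⇐ a b c d le = ℤP.≮⇒≥ (λ lt → ℕP.<-irrefl refl (ℕP.<-≤-trans (sub<sub⇒ c d a b lt) le))

  ℤ≡sub : ∀ x → Σ ℕ (λ a → Σ ℕ (λ b → x ≡ + a -ᶻ + b))
  ℤ≡sub (+ a)    = a , 0 , sym (ℤP.+-identityʳ (+ a))
  ℤ≡sub -[1+ a ] = 0 , suc a , refl

  rowLen-suc-≤ : ∀ {l} → IsPartition l → ∀ r → rowLen l (suc r) ≤ rowLen l r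
  rowLen-suc-≤ {[]}          _                  r       = z≤n
  rowLen-suc-≤ {x ∷ []}      _                  zero    = z≤n
  rowLen-suc-≤ {x ∷ []}      _                  (suc r) = z≤n
  rowLen-suc-≤ {x ∷ y ∷ l} (y≤x ∷ _ , _)      zero    = y≤x
  rowLen-suc-≤ {x ∷ y ∷ l} (_ ∷ lk , _ ∷ ap) (suc r) = rowLen-suc-≤ {y ∷ l} (lk , ap) r

  rowLen-antitone : ∀ {l} → IsPartition l → ∀ {r s} → r ≤ s → rowLen l s ≤ rowLen l r
  rowLen-antitone {l} P {r} r≤s with ℕP.m≤n⇒∃[o]m+o≡n r≤s
  ... | o , refl = go o
    where
    go : ∀ o → rowLen l (r + o) ≤ rowLen l r
    go zero    = ℕP.≤-reflexive (cong (rowLen l) (ℕP.+-identityʳ r))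
    go (suc o) = ℕP.≤-trans (ℕP.≤-reflexive (cong (rowLen l) (ℕP.+-suc r o)))
                            (ℕP.≤-trans (rowLen-suc-≤ P (r + o)) (go o))

  rowLen-beyond : ∀ l r → length l ≤ r → rowLen l r ≡ 0
  rowLen-beyond []      r       _        = refl
  rowLen-beyond (x ∷ l) (suc r) (s≤s le) = rowLen-beyond l r le

  rowLen-pos : ∀ {l} → All (0 <_) l → ∀ r → r < length l → 0 < rowLen l r
  rowLen-pos (px ∷ _) zero    _        = px
  rowLen-pos (_ ∷ ap) (suc r) (s≤s lt) = rowLen-pos ap r lt

  rowLen-ext : ∀ {l l′} → All (0 <_) l → All (0 <_) l′ → (∀ r → rowLen l r ≡ rowLen l′ r) → l ≡ l′
  rowLen-ext []       []       e = refl
  rowLen-ext []       (px ∷ _) e = ⊥-elim (ℕP.<-irrefl (e 0) px)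
  rowLen-ext (px ∷ _) []       e = ⊥-elim (ℕP.<-irrefl (sym (e 0)) px)
  rowLen-ext (_ ∷ a)  (_ ∷ b)  e = cong₂ _∷_ (e 0) (rowLen-ext a b (λ r → e (suc r)))

  -- Adding a box in row r raises β l r by one; the new bead position is the content of the box plus 1.
  β : List ℕ → ℕ → ℤ
  β l r = + rowLen l r -ᶻ + r

  _∈β_ : ℤ → List ℕ → Set
  x ∈β l = Σ ℕ (λ r → β l r ≡ x)

  β-decreasing : ∀ {l} → IsPartition l → ∀ {r s} → r < s → β l s <ᶻ β l r
  β-decreasing {l} P {r} {s} r<s =
    sub<sub⇐ (rowLen l s) s (rowLen l r) r (ℕP.+-mono-≤-< (rowLen-antitone P (ℕP.<⇒≤ r<s)) r<s)

  β-nonincreasing : ∀ {l} → IsPartition l → ∀ {r s} → r ≤ s → β l s ≤ᶻ β l r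
  β-nonincreasing P r≤s with ℕP.m≤n⇒m<n∨m≡n r≤s
  ... | inj₁ lt   = ℤP.<⇒≤ (β-decreasing P lt)
  ... | inj₂ refl = ℤP.≤-refl

  β-injective : ∀ {l} → IsPartition l → ∀ {r s} → β l r ≡ β l s → r ≡ s
  β-injective P {r} {s} e with ℕP.<-cmp r s
  ... | tri< lt _ _ = ⊥-elim (ℤP.<-irrefl (sym e) (β-decreasing P lt))
  ... | tri≈ _ eq _ = eq
  ... | tri> _ _ gt = ⊥-elim (ℤP.<-irrefl e (β-decreasing P gt))

  β-ext : ∀ {l l′} → IsPartition l → IsPartition l′ →
          (∀ x → x ∈β l → x ∈β l′) → (∀ x → x ∈β l′ → x ∈β l) → l ≡ l′
  β-ext {l} {l′} P P′ f g = rowLen-ext (proj₂ P) (proj₂ P′) (λ r →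
    ℕP.+-cancelʳ-≡ r _ _ (sub≡sub⇒ (rowLen l r) r (rowLen l′ r) r (<-rec _ same-β r)))
    where
    -- If the first r beads agree, the (r+1)-st bead of either is the largest remaining one.
    below : ∀ {l l′} → IsPartition l → IsPartition l′ → (∀ x → x ∈β l → x ∈β l′) →
            ∀ r → (∀ {k} → k < r → β l k ≡ β l′ k) → β l r ≤ᶻ β l′ r
    below {l} {l′} P P′ f r ih with f _ (r , refl)
    ... | s , e with ℕP.<-cmp s r
    ... | tri< s<r _ _ = ⊥-elim (ℕP.<-irrefl (β-injective P (trans (ih s<r) e)) s<r)
    ... | tri≈ _ refl _ = ℤP.≤-reflexive (sym e)
    ... | tri> _ _ r<s = subst (_≤ᶻ β l′ r) e (β-nonincreasing P′ (ℕP.<⇒≤ r<s))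
    same-β : ∀ r → (∀ {k} → k < r → β l k ≡ β l′ k) → β l r ≡ β l′ r
    same-β r ih = ℤP.≤-antisym (below P P′ f r ih) (below P′ P g r (λ k<r → sym (ih k<r)))

  sumTo : (ℕ → ℕ) → ℕ → ℕ
  sumTo f zero    = 0
  sumTo f (suc R) = sumTo f R + f R

  sumTo-front : ∀ f R → sumTo f (suc R) ≡ f 0 + sumTo (λ r → f (suc r)) R
  sumTo-front f zero    = ℕP.+-comm 0 (f 0)
  sumTo-front f (suc R) = trans (cong (_+ f (suc R)) (sumTo-front f R)) (ℕP.+-assoc (f 0) _ _)

  sumTo-stable : ∀ f A B → A ≤ B → (∀ r → A ≤ r → r < B → f r ≡ 0) → sumTo f B ≡ sumTo f A
  sumTo-stable f A B le h with ℕP.m≤n⇒∃[o]m+o≡n le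
  ... | o , refl = zeros o (λ k lt → h (A + k) (ℕP.m≤m+n A k) (ℕP.+-monoʳ-< A lt))
    where
    zeros : ∀ o → (∀ k → k < o → f (A + k) ≡ 0) → sumTo f (A + o) ≡ sumTo f A
    zeros zero    z = cong (sumTo f) (ℕP.+-identityʳ A)
    zeros (suc o) z = begin
      sumTo f (A + suc o)             ≡⟨ cong (sumTo f) (ℕP.+-suc A o) ⟩
      sumTo f (A + o) + f (A + o)     ≡⟨ cong₂ _+_ (zeros o (λ k lt → z k (ℕP.m≤n⇒m≤1+n lt))) (z o ℕP.≤-refl) ⟩
      sumTo f A + 0                   ≡⟨ ℕP.+-identityʳ _ ⟩
      sumTo f A                       ∎
      where open ≡-Reasoning

  sumTo-zero : ∀ f R → (∀ r → r < R → f r ≡ 0) → sumTo f R ≡ 0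
  sumTo-zero f R h = sumTo-stable f 0 R z≤n (λ r _ lt → h r lt)

  sumTo-ones : ∀ f A B → A ≤ B → (∀ r → A ≤ r → r < B → f r ≡ 1) → sumTo f B + A ≡ sumTo f A + B
  sumTo-ones f A B le h with ℕP.m≤n⇒∃[o]m+o≡n le
  ... | o , refl = begin
    sumTo f (A + o) + A   ≡⟨ cong (_+ A) (ones o (λ k lt → h (A + k) (ℕP.m≤m+n A k) (ℕP.+-monoʳ-< A lt))) ⟩
    sumTo f A + o + A     ≡⟨ ℕP.+-assoc (sumTo f A) o A ⟩
    sumTo f A + (o + A)   ≡⟨ cong (_+_ (sumTo f A)) (ℕP.+-comm o A) ⟩
    sumTo f A + (A + o)   ∎
    where
    open ≡-Reasoning
    ones : ∀ o → (∀ k → k < o → f (A + k) ≡ 1) → sumTo f (A + o) ≡ sumTo f A + o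
    ones zero    u = trans (cong (sumTo f) (ℕP.+-identityʳ A)) (sym (ℕP.+-identityʳ _))
    ones (suc o) u = begin
      sumTo f (A + suc o)           ≡⟨ cong (sumTo f) (ℕP.+-suc A o) ⟩
      sumTo f (A + o) + f (A + o)   ≡⟨ cong₂ _+_ (ones o (λ k lt → u k (ℕP.m≤n⇒m≤1+n lt))) (u o ℕP.≤-refl) ⟩
      sumTo f A + o + 1             ≡⟨ ℕP.+-assoc (sumTo f A) o 1 ⟩
      sumTo f A + (o + 1)           ≡⟨ cong (_+_ (sumTo f A)) (ℕP.+-comm o 1) ⟩
      sumTo f A + suc o             ∎

  sumTo-indicator : ∀ f lo hi R → lo ≤ hi → hi ≤ R →
    (∀ r → r < lo → f r ≡ 0) → (∀ r → lo ≤ r → r < hi → f r ≡ 1) → (∀ r → hi ≤ r → r < R → f r ≡ 0) →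
    sumTo f R + lo ≡ hi
  sumTo-indicator f lo hi R le1 le2 h0 h1 h2 =
    trans (cong (_+ lo) (sumTo-stable f hi R le2 h2))
          (trans (sumTo-ones f lo hi le1 h1) (cong (_+ hi) (sumTo-zero f lo h0)))

  -- G is F with the entries at lo, …, hi - 1 shifted one index later and raised by δ, a new
  -- entry G lo inserted and the entry F hi dropped.
  module ShiftedSum (F G : ℕ → ℕ) (lo hi δ : ℕ) (le : lo ≤ hi)
    (h-before : ∀ r → r < lo → G r ≡ F r)
    (h-shift : ∀ r → lo ≤ r → r < hi → G (suc r) ≡ F r + δ)
    (h-after : ∀ r → hi < r → G r ≡ F r) where

    open ℕ-Solver

    private
      sum-before : ∀ R → R ≤ lo → sumTo G R ≡ sumTo F R
      sum-before zero    _  = refl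
      sum-before (suc R) lt = cong₂ _+_ (sum-before R (ℕP.≤-trans (ℕP.n≤1+n R) lt)) (h-before R lt)

      sum-partial : ∀ m → lo ≤ m → m ≤ hi →
                    sumTo G (suc m) + F m + δ * lo ≡ sumTo F (suc m) + G lo + δ * m
      sum-partial m l1 l2 with ℕP.m≤n⇒m<n∨m≡n l1
      ... | inj₂ refl rewrite sum-before m ℕP.≤-refl =
        solve 4 (λ S g f d → S :+ g :+ f :+ d := S :+ f :+ g :+ d) refl (sumTo F m) (G m) (F m) (δ * m)
      sum-partial (suc m) l1 l2 | inj₁ lo<m = begin
        sumTo G (suc m) + G (suc m) + F (suc m) + δ * lo
          ≡⟨ cong (λ z → sumTo G (suc m) + z + F (suc m) + δ * lo) (h-shift m (ℕP.≤-pred lo<m) l2) ⟩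
        sumTo G (suc m) + (F m + δ) + F (suc m) + δ * lo
          ≡⟨ solve 5 (λ S a d b x → S :+ (a :+ d) :+ b :+ x := (S :+ a :+ x) :+ b :+ d) refl
                     (sumTo G (suc m)) (F m) δ (F (suc m)) (δ * lo) ⟩
        (sumTo G (suc m) + F m + δ * lo) + F (suc m) + δ
          ≡⟨ cong (λ z → z + F (suc m) + δ) (sum-partial m (ℕP.≤-pred lo<m) (ℕP.≤-trans (ℕP.n≤1+n m) l2)) ⟩
        (sumTo F (suc m) + G lo + δ * m) + F (suc m) + δ
          ≡⟨ solve 5 (λ S g x b d → (S :+ g :+ x) :+ b :+ d := S :+ b :+ g :+ (d :+ x)) refl
                     (sumTo F (suc m)) (G lo) (δ * m) (F (suc m)) δ ⟩
        sumTo F (suc m) + F (suc m) + G lo + (δ + δ * m)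
          ≡⟨ cong (_+_ (sumTo F (suc m) + F (suc m) + G lo)) (sym (ℕP.*-suc δ m)) ⟩
        sumTo F (suc m) + F (suc m) + G lo + δ * suc m ∎
        where open ≡-Reasoning

    sum-shifted : ∀ R → hi < R → sumTo G R + F hi + δ * lo ≡ sumTo F R + G lo + δ * hi
    sum-shifted (suc m) lt with ℕP.m≤n⇒m<n∨m≡n (ℕP.≤-pred lt)
    ... | inj₂ refl = sum-partial hi le ℕP.≤-refl
    ... | inj₁ hi<m rewrite h-after m hi<m =
      trans (solve 4 (λ S f a b → S :+ f :+ a :+ b := S :+ a :+ b :+ f) refl (sumTo G m) (F m) (F hi) (δ * lo))
       (trans (cong (_+ F m) (sum-shifted m hi<m))
        (solve 4 (λ S g x f → S :+ g :+ x :+ f := S :+ f :+ g :+ x) refl (sumTo F m) (G lo) (δ * hi) (F m)))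

  size≡sumTo : ∀ l → size l ≡ sumTo (rowLen l) (length l)
  size≡sumTo []      = refl
  size≡sumTo (x ∷ l) = trans (cong (_+_ x) (size≡sumTo l)) (sym (sumTo-front (rowLen (x ∷ l)) (length l)))

  size≡sumTo-beyond : ∀ l R → length l ≤ R → size l ≡ sumTo (rowLen l) R
  size≡sumTo-beyond l R le =
    trans (size≡sumTo l) (sym (sumTo-stable (rowLen l) (length l) R le (λ r le′ _ → rowLen-beyond l r le′)))

  -- μ/λ occupies rows r0, …, rt with head box (r0, c0); row r+1 of μ/λ ends exactly one column
  -- after row r of λ ends, so consecutive rows overlap in one column.  size-condition says the
  -- skew shape has n boxes.
  record RibbonRows (n : ℕ) (lam mu : List ℕ) (i : ℤ) : Set where
    field
      r0 rt c0       : ℕ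
      r0≤rt          : r0 ≤ rt
      head-content   : + c0 -ᶻ + r0 ≡ i
      before         : ∀ r → r < r0 → rowLen mu r ≡ rowLen lam r
      head           : rowLen mu r0 ≡ suc c0
      head-free      : rowLen lam r0 ≤ c0
      body           : ∀ r → r0 ≤ r → r < rt → rowLen mu (suc r) ≡ suc (rowLen lam r)
      after          : ∀ r → rt < r → rowLen mu r ≡ rowLen lam r
      size-condition : rowLen lam rt + r0 + n ≡ c0 + 1 + rt

  data RowCase (r0 rt r : ℕ) : Set where
    row-before : r < r0 → RowCase r0 rt r
    row-head   : r ≡ r0 → RowCase r0 rt r
    row-body   : ∀ k → r ≡ suc k → r0 ≤ k → k < rt → RowCase r0 rt r
    row-after  : rt < r → RowCase r0 rt r

  rowCase : ∀ r0 rt r → r0 ≤ rt → RowCase r0 rt r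
  rowCase r0 rt r le with ℕP.<-cmp r r0
  ... | tri< x _ _ = row-before x
  ... | tri≈ _ x _ = row-head x
  ... | tri> _ _ x with rt <? r
  ...   | yes y = row-after y
  ...   | no y with r
  ...     | suc k = row-body k refl (ℕP.≤-pred x) (ℕP.<-≤-trans (ℕP.n<1+n k) (ℕP.≮⇒≥ y))

  SkewRow : List ℕ → List ℕ → ℕ → Set
  SkewRow lam mu r = rowLen lam r < rowLen mu r

  skewRow<length : ∀ {lam mu} r → SkewRow lam mu r → r < length mu
  skewRow<length {lam} {mu} r s = ℕP.≰⇒> (λ le → ℕP.n≮0 (subst (rowLen lam r <_) (rowLen-beyond mu r le) s))

  size-by-rows : ∀ lam mu r0 rt → r0 ≤ rt →
    (∀ r → r < r0 → rowLen mu r ≡ rowLen lam r) →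
    (∀ r → r0 ≤ r → r < rt → rowLen mu (suc r) ≡ suc (rowLen lam r)) →
    (∀ r → rt < r → rowLen mu r ≡ rowLen lam r) →
    size mu + rowLen lam rt + r0 ≡ size lam + rowLen mu r0 + rt
  size-by-rows lam mu r0 rt r0≤rt before body after = begin
    size mu + rowLen lam rt + r0              ≡⟨ cong₂ (λ a b → a + rowLen lam rt + b) (size≡sumTo-beyond mu R mu≤R) (sym (ℕP.*-identityˡ r0)) ⟩
    sumTo (rowLen mu) R + rowLen lam rt + 1 * r0  ≡⟨ sum-shifted R (s≤s (ℕP.m≤n+m rt _)) ⟩
    sumTo (rowLen lam) R + rowLen mu r0 + 1 * rt  ≡⟨ cong₂ (λ a b → a + rowLen mu r0 + b) (sym (size≡sumTo-beyond lam R lam≤R)) (ℕP.*-identityˡ rt) ⟩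
    size lam + rowLen mu r0 + rt              ∎
    where
    open ≡-Reasoning
    open ShiftedSum (rowLen lam) (rowLen mu) r0 rt 1 r0≤rt before (λ r a b → trans (body r a b) (ℕP.+-comm 1 _)) after
    R : ℕ
    R = suc (length lam + length mu + rt)
    lam≤R : length lam ≤ R
    lam≤R = ℕP.≤-trans (ℕP.m≤m+n (length lam) (length mu)) (ℕP.≤-trans (ℕP.m≤m+n _ rt) (ℕP.n≤1+n _))
    mu≤R : length mu ≤ R
    mu≤R = ℕP.≤-trans (ℕP.m≤n+m (length mu) (length lam)) (ℕP.≤-trans (ℕP.m≤m+n _ rt) (ℕP.n≤1+n _))

  module RowsProperties {n : ℕ} {lam mu : List ℕ} {i : ℤ} (rs : RibbonRows n lam mu i) (Pl : IsPartition lam) where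
    open RibbonRows rs

    skewRow⇒inside : ∀ r → SkewRow lam mu r → r0 ≤ r × r ≤ rt
    skewRow⇒inside r s with rowCase r0 rt r r0≤rt
    ... | row-before x       = ⊥-elim (ℕP.<-irrefl (sym (before r x)) s)
    ... | row-head refl      = ℕP.≤-refl , r0≤rt
    ... | row-body k refl a b = ℕP.≤-trans a (ℕP.n≤1+n k) , b
    ... | row-after x        = ⊥-elim (ℕP.<-irrefl (sym (after r x)) s)

    inside⇒skewRow : ∀ r → r0 ≤ r → r ≤ rt → SkewRow lam mu r
    inside⇒skewRow r a b with rowCase r0 rt r r0≤rt
    ... | row-before x         = ⊥-elim (ℕP.<-irrefl refl (ℕP.<-≤-trans x a))
    ... | row-head refl        = subst (rowLen lam r <_) (sym head) (s≤s head-free)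
    ... | row-body k refl a′ b′ = subst (rowLen lam (suc k) <_) (sym (body k a′ b′)) (s≤s (rowLen-suc-≤ Pl k))
    ... | row-after x          = ⊥-elim (ℕP.<-irrefl refl (ℕP.<-≤-trans x b))

    lam⊆mu : lam ⊆Y mu
    lam⊆mu r with rowCase r0 rt r r0≤rt
    ... | row-before x       = ℕP.≤-reflexive (sym (before r x))
    ... | row-head refl      = ℕP.<⇒≤ (inside⇒skewRow r ℕP.≤-refl r0≤rt)
    ... | row-body k refl a b = ℕP.<⇒≤ (inside⇒skewRow (suc k) (ℕP.≤-trans a (ℕP.n≤1+n k)) b)
    ... | row-after x        = ℕP.≤-reflexive (sym (after r x))

    size-ribbon : size mu ≡ size lam + n
    size-ribbon = ℕP.+-cancelʳ-≡ (rowLen lam rt + r0) _ _ (begin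
      size mu + (rowLen lam rt + r0)     ≡⟨ sym (ℕP.+-assoc (size mu) _ _) ⟩
      size mu + rowLen lam rt + r0       ≡⟨ size-by-rows lam mu r0 rt r0≤rt before body after ⟩
      size lam + rowLen mu r0 + rt       ≡⟨ cong (λ z → size lam + z + rt) head ⟩
      size lam + suc c0 + rt             ≡⟨ solve 3 (λ S c t → S :+ (con 1 :+ c) :+ t := S :+ (c :+ con 1 :+ t)) refl (size lam) c0 rt ⟩
      size lam + (c0 + 1 + rt)           ≡⟨ cong (_+_ (size lam)) (sym size-condition) ⟩
      size lam + (rowLen lam rt + r0 + n) ≡⟨ solve 3 (λ S x m → S :+ (x :+ m) := S :+ m :+ x) refl (size lam) (rowLen lam rt + r0) n ⟩
      size lam + n + (rowLen lam rt + r0) ∎)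
      where
      open ≡-Reasoning
      open ℕ-Solver

  adj-sym : ∀ {a b} → Adj a b → Adj b a
  adj-sym (inj₁ (refl , inj₁ x)) = inj₁ (refl , inj₂ x)
  adj-sym (inj₁ (refl , inj₂ x)) = inj₁ (refl , inj₁ x)
  adj-sym (inj₂ (refl , inj₁ x)) = inj₂ (refl , inj₂ x)
  adj-sym (inj₂ (refl , inj₂ x)) = inj₂ (refl , inj₁ x)

  reach-trans : ∀ {l m a b d} → Reach l m a b → Reach l m b d → Reach l m a d
  reach-trans here         q = q
  reach-trans (step x y p) q = step x y (reach-trans p q)

  reach-sym : ∀ {l m a d} → InSkew l m a → Reach l m a d → Reach l m d a
  reach-sym ia here            = here
  reach-sym ia (step adj ib p) = reach-trans (reach-sym ib p) (step (adj-sym adj) ia here)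

  reach-along-row : ∀ {l m} r c e → c ≤ e → (∀ c′ → c ≤ c′ → c′ ≤ e → InSkew l m (r , c′)) →
                    Reach l m (r , c) (r , e)
  reach-along-row {l} {m} r c e le h with ℕP.m≤n⇒∃[o]m+o≡n le
  ... | k , refl = walk c k (λ j le′ → h (c + j) (ℕP.m≤m+n c j) (ℕP.+-monoʳ-≤ c le′))
    where
    walk : ∀ c k → (∀ j → j ≤ k → InSkew l m (r , c + j)) → Reach l m (r , c) (r , c + k)
    walk c zero    h = subst (λ z → Reach l m (r , c) (r , z)) (sym (ℕP.+-identityʳ c)) here
    walk c (suc k) h =
      step (inj₁ (refl , inj₁ refl)) (subst (λ z → InSkew l m (r , z)) (ℕP.+-comm c 1) (h 1 (s≤s z≤n)))
        (subst (λ z → Reach l m (r , suc c) (r , z)) (sym (ℕP.+-suc c k))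
          (walk (suc c) k (λ j le → subst (λ z → InSkew l m (r , z)) (ℕP.+-suc c j) (h (suc j) (s≤s le)))))

  module RowsRibbon {n : ℕ} {lam mu : List ℕ} {i : ℤ} (rs : RibbonRows n lam mu i)
                    (Pl : IsPartition lam) (Pm : IsPartition mu) where
    open RibbonRows rs
    open RowsProperties rs Pl

    headBox : Box
    headBox = (r0 , c0)

    headBox∈ : InSkew lam mu headBox
    headBox∈ = head-free , subst (c0 <_) (sym head) ℕP.≤-refl

    -- Walk right to the end of the row, then up through the overlap column.
    reach-head : ∀ d r c → r ≡ r0 + d → InSkew lam mu (r , c) → Reach lam mu (r , c) headBox
    reach-head zero r c e (a , b) rewrite ℕP.+-identityʳ r0 | e =
      reach-along-row r0 c c0 (ℕP.≤-pred (subst (c <_) head b))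
        (λ c′ le1 le2 → ℕP.≤-trans a le1 , subst (c′ <_) (sym head) (s≤s le2))
    reach-head (suc d) r c e (a , b) rewrite ℕP.+-suc r0 d | e =
      reach-trans along (step (inj₂ (refl , inj₂ refl)) up (reach-head d k (rowLen lam k) refl up))
      where
      k : ℕ
      k = r0 + d
      sk≤rt : suc k ≤ rt
      sk≤rt = proj₂ (skewRow⇒inside (suc k) (ℕP.≤-<-trans a b))
      row-sk : rowLen mu (suc k) ≡ suc (rowLen lam k)
      row-sk = body k (ℕP.m≤m+n r0 d) sk≤rt
      along : Reach lam mu (suc k , c) (suc k , rowLen lam k)
      along = reach-along-row (suc k) c (rowLen lam k) (ℕP.≤-pred (subst (c <_) row-sk b))
        (λ c′ le1 le2 → ℕP.≤-trans a le1 , subst (c′ <_) (sym row-sk) (s≤s le2))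
      up : InSkew lam mu (k , rowLen lam k)
      up = ℕP.≤-refl , inside⇒skewRow k (ℕP.m≤m+n r0 d) (ℕP.≤-trans (ℕP.n≤1+n k) sk≤rt)

    reach-headBox : ∀ b → InSkew lam mu b → Reach lam mu b headBox
    reach-headBox (r , c) ib with ℕP.m≤n⇒∃[o]m+o≡n (proj₁ (skewRow⇒inside r (ℕP.≤-<-trans (proj₁ ib) (proj₂ ib))))
    ... | d , e = reach-head d r c (sym e) ib

    connected : Connected lam mu
    connected a b ia ib = reach-trans (reach-headBox a ia) (reach-sym ib (reach-headBox b ib))

    no2×2 : No2×2 lam mu
    no2×2 (r , c , (a1 , b1) , _ , (a3 , b3) , (_ , b4)) =
      ℕP.<-irrefl refl (ℕP.≤-<-trans a1 (ℕP.≤-pred (subst (suc c <_) row-sr b4)))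
      where
      row-sr : rowLen mu (suc r) ≡ suc (rowLen lam r)
      row-sr = body r (proj₁ (skewRow⇒inside r (ℕP.≤-<-trans a1 b1)))
                      (proj₂ (skewRow⇒inside (suc r) (ℕP.≤-<-trans a3 b3)))

    isHead : IsHead lam mu headBox
    isHead = headBox∈ , λ r′ c′ ib → proj₁ (skewRow⇒inside r′ (ℕP.≤-<-trans (proj₁ ib) (proj₂ ib))) ,
      λ { refl → ℕP.≤-pred (subst (c′ <_) head (proj₂ ib)) }

    ribbon : IsRibbonAdd n lam mu i
    ribbon = Pm , lam⊆mu , size-ribbon , connected , no2×2 , (headBox , isHead , head-content)

  crossing-column : ∀ {lam mu} k a d → InSkew lam mu a → proj₁ a ≤ k → k < proj₁ d → Reach lam mu a d →
                    Σ ℕ (λ c → InSkew lam mu (k , c) × InSkew lam mu (suc k , c))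
  crossing-column k a a ia le lt here = ⊥-elim (ℕP.<-irrefl refl (ℕP.≤-<-trans le lt))
  crossing-column k (r , c) d ia le lt (step {b = (r′ , c′)} adj ib p) with r′ ≤? k
  ... | yes le′ = crossing-column k (r′ , c′) d ib le′ lt p
  ... | no nle with adj
  ...   | inj₁ (refl , _)        = ⊥-elim (nle le)
  ...   | inj₂ (refl , inj₂ refl) = ⊥-elim (nle (ℕP.≤-trans (ℕP.n≤1+n r′) le))
  ...   | inj₂ (refl , inj₁ refl) with ℕP.≤-antisym le (ℕP.≤-pred (ℕP.≰⇒> nle))
  ...     | refl = c , ia , ib

  -- If row k+1 of μ went past column rowLen λ k, the boxes at columns rowLen λ k and
  -- rowLen λ k + 1 of rows k, k+1 would form a 2×2 square.
  overlap⇒body : ∀ {lam mu} → IsPartition lam → IsPartition mu → No2×2 lam mu → ∀ k →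
                 Σ ℕ (λ c → InSkew lam mu (k , c) × InSkew lam mu (suc k , c)) →
                 rowLen mu (suc k) ≡ suc (rowLen lam k)
  overlap⇒body {lam} {mu} Pl Pm no2×2 k (c , (a1 , _) , (_ , b2)) with rowLen mu (suc k) ≤? suc (rowLen lam k)
  ... | yes le = ℕP.≤-antisym le (ℕP.≤-<-trans a1 b2)
  ... | no nle = ⊥-elim (no2×2 (k , a ,
          (ℕP.≤-refl , ℕP.<-≤-trans a<mk1 (rowLen-suc-≤ Pm k)) ,
          (ℕP.n≤1+n a , ℕP.<-≤-trans a1<mk1 (rowLen-suc-≤ Pm k)) ,
          (rowLen-suc-≤ Pl k , a<mk1) ,
          (ℕP.≤-trans (rowLen-suc-≤ Pl k) (ℕP.n≤1+n a) , a1<mk1)))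
    where
    a : ℕ
    a = rowLen lam k
    a1<mk1 : suc a < rowLen mu (suc k)
    a1<mk1 = ℕP.≰⇒> nle
    a<mk1 : a < rowLen mu (suc k)
    a<mk1 = ℕP.<-trans (ℕP.n<1+n a) a1<mk1

  lastSkewRow : ∀ {lam mu} m k → SkewRow lam mu k → length mu ≤ k + m →
                Σ ℕ (λ t → k ≤ t × SkewRow lam mu t × ¬ SkewRow lam mu (suc t))
  lastSkewRow {lam} {mu} zero k s le =
    ⊥-elim (ℕP.<-irrefl refl (ℕP.<-≤-trans (skewRow<length {lam} {mu} k s) (subst (length mu ≤_) (ℕP.+-identityʳ k) le)))
  lastSkewRow {lam} {mu} (suc m) k s le with rowLen lam (suc k) <? rowLen mu (suc k)
  ... | no ns = k , ℕP.≤-refl , s , ns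
  ... | yes s′ with lastSkewRow {lam} {mu} m (suc k) s′ (subst (length mu ≤_) (ℕP.+-suc k m) le)
  ...   | t , a , b , c = t , ℕP.≤-trans (ℕP.n≤1+n k) a , b , c

  ribbonRows : ∀ {n lam mu i} → IsPartition lam → IsRibbonAdd n lam mu i → RibbonRows n lam mu i
  ribbonRows {n} {lam} {mu} {i} Pl (Pm , lam⊆mu , sz , cn , no2×2 , (r0 , c0) , (head∈ , head-max) , head-content) =
    record { r0 = r0 ; rt = rt ; c0 = c0 ; r0≤rt = r0≤rt ; head-content = head-content
           ; before = before ; head = head ; head-free = proj₁ head∈ ; body = body ; after = after
           ; size-condition = size-condition }
    where
    skewRow0 : SkewRow lam mu r0
    skewRow0 = ℕP.≤-<-trans (proj₁ head∈) (proj₂ head∈)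

    not-skew : ∀ r → ¬ SkewRow lam mu r → rowLen mu r ≡ rowLen lam r
    not-skew r ns = ℕP.≤-antisym (ℕP.≮⇒≥ ns) (lam⊆mu r)

    before : ∀ r → r < r0 → rowLen mu r ≡ rowLen lam r
    before r lt = not-skew r (λ s → ℕP.<-irrefl refl (ℕP.<-≤-trans lt (proj₁ (head-max r _ (ℕP.≤-refl , s)))))

    head : rowLen mu r0 ≡ suc c0
    head with rowLen mu r0 in e | proj₂ head∈
    ... | suc m | c0<m = cong suc (ℕP.≤-antisym
      (proj₂ (head-max r0 m (ℕP.≤-trans (proj₁ head∈) (ℕP.≤-pred c0<m) , subst (m <_) (sym e) ℕP.≤-refl)) refl)
      (ℕP.≤-pred c0<m))

    -- A path from the head box to row r crosses each row boundary in between in an overlap column.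
    body-upto : ∀ r → SkewRow lam mu r → ∀ k → r0 ≤ k → k < r → rowLen mu (suc k) ≡ suc (rowLen lam k)
    body-upto r s k le lt = overlap⇒body Pl Pm no2×2 k
      (crossing-column k (r0 , c0) (r , rowLen lam r) head∈ le lt (cn _ _ head∈ (ℕP.≤-refl , s)))

    last : Σ ℕ (λ t → r0 ≤ t × SkewRow lam mu t × ¬ SkewRow lam mu (suc t))
    last = lastSkewRow {lam} {mu} (length mu) r0 skewRow0 (ℕP.m≤n+m (length mu) r0)
    rt : ℕ
    rt = proj₁ last
    r0≤rt : r0 ≤ rt
    r0≤rt = proj₁ (proj₂ last)

    body : ∀ r → r0 ≤ r → r < rt → rowLen mu (suc r) ≡ suc (rowLen lam r)
    body = body-upto rt (proj₁ (proj₂ (proj₂ last)))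

    after : ∀ r → rt < r → rowLen mu r ≡ rowLen lam r
    after r lt = not-skew r (λ s → proj₂ (proj₂ (proj₂ last))
      (subst (rowLen lam (suc rt) <_) (sym (body-upto r s rt r0≤rt lt)) (s≤s (rowLen-suc-≤ Pl rt))))

    size-condition : rowLen lam rt + r0 + n ≡ c0 + 1 + rt
    size-condition = ℕP.+-cancelˡ-≡ (size lam) _ _ (begin
      size lam + (rowLen lam rt + r0 + n)  ≡⟨ solve 4 (λ S a b m → S :+ (a :+ b :+ m) := S :+ m :+ a :+ b) refl (size lam) (rowLen lam rt) r0 n ⟩
      size lam + n + rowLen lam rt + r0    ≡⟨ cong (λ z → z + rowLen lam rt + r0) (sym sz) ⟩
      size mu + rowLen lam rt + r0         ≡⟨ size-by-rows lam mu r0 rt r0≤rt before body after ⟩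
      size lam + rowLen mu r0 + rt         ≡⟨ cong (λ z → size lam + z + rt) head ⟩
      size lam + suc c0 + rt               ≡⟨ solve 3 (λ S c t → S :+ (con 1 :+ c) :+ t := S :+ (c :+ con 1 :+ t)) refl (size lam) c0 rt ⟩
      size lam + (c0 + 1 + rt)             ∎)
      where
      open ≡-Reasoning
      open ℕ-Solver

  rowLen-applyUpTo< : ∀ f L r → r < L → rowLen (applyUpTo f L) r ≡ f r
  rowLen-applyUpTo< f (suc L) zero    _        = refl
  rowLen-applyUpTo< f (suc L) (suc r) (s≤s lt) = rowLen-applyUpTo< (λ r → f (suc r)) L r lt

  rowLen-applyUpTo≥ : ∀ f L r → L ≤ r → rowLen (applyUpTo f L) r ≡ 0
  rowLen-applyUpTo≥ f zero    r       _        = refl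
  rowLen-applyUpTo≥ f (suc L) (suc r) (s≤s le) = rowLen-applyUpTo≥ (λ r → f (suc r)) L r le

  applyUpTo-positive : ∀ f L → (∀ r → r < L → 0 < f r) → All (0 <_) (applyUpTo f L)
  applyUpTo-positive f zero    h = []
  applyUpTo-positive f (suc L) h = h 0 (s≤s z≤n) ∷ applyUpTo-positive (λ r → f (suc r)) L (λ r lt → h (suc r) (s≤s lt))

  applyUpTo-linked : ∀ f L → (∀ r → f (suc r) ≤ f r) → Linked ℕ._≥_ (applyUpTo f L)
  applyUpTo-linked f zero          h = []
  applyUpTo-linked f (suc zero)    h = [-]
  applyUpTo-linked f (suc (suc L)) h = h 0 ∷ applyUpTo-linked (λ r → f (suc r)) (suc L) (λ r → h (suc r))

  module BuildRibbon (n : ℕ) (lam : List ℕ) (Pl : IsPartition lam) (r0 rt c0 : ℕ) (r0≤rt : r0 ≤ rt)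
    (head-free : rowLen lam r0 ≤ c0) (above-head : ∀ k → suc k ≡ r0 → suc c0 ≤ rowLen lam k)
    (size-condition : rowLen lam rt + r0 + n ≡ c0 + 1 + rt) where

    rowValue : ∀ {r} → RowCase r0 rt r → ℕ
    rowValue {r} (row-before _)     = rowLen lam r
    rowValue     (row-head _)       = suc c0
    rowValue     (row-body k _ _ _) = suc (rowLen lam k)
    rowValue {r} (row-after _)      = rowLen lam r

    muRow : ℕ → ℕ
    muRow r = rowValue (rowCase r0 rt r r0≤rt)

    muRow-before : ∀ r → r < r0 → muRow r ≡ rowLen lam r
    muRow-before r lt with rowCase r0 rt r r0≤rt
    ... | row-before _       = refl
    ... | row-head refl      = ⊥-elim (ℕP.<-irrefl refl lt)
    ... | row-body k refl a b = ⊥-elim (ℕP.<-irrefl refl (ℕP.<-≤-trans lt (ℕP.≤-trans a (ℕP.n≤1+n k))))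
    ... | row-after x        = ⊥-elim (ℕP.<-irrefl refl (ℕP.<-trans lt (ℕP.≤-<-trans r0≤rt x)))

    muRow-head : muRow r0 ≡ suc c0
    muRow-head with rowCase r0 rt r0 r0≤rt
    ... | row-before x     = ⊥-elim (ℕP.<-irrefl refl x)
    ... | row-head _       = refl
    ... | row-body k e a b = ⊥-elim (ℕP.<-irrefl refl (ℕP.≤-<-trans a (subst (k <_) (sym e) ℕP.≤-refl)))
    ... | row-after x      = ⊥-elim (ℕP.<-irrefl refl (ℕP.≤-<-trans r0≤rt x))

    muRow-body : ∀ r → r0 ≤ r → r < rt → muRow (suc r) ≡ suc (rowLen lam r)
    muRow-body r a b with rowCase r0 rt (suc r) r0≤rt
    ... | row-before x       = ⊥-elim (ℕP.<-irrefl refl (ℕP.<-≤-trans x (ℕP.≤-trans a (ℕP.n≤1+n r))))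
    ... | row-head e         = ⊥-elim (ℕP.<-irrefl refl (ℕP.<-≤-trans (subst (r <_) e ℕP.≤-refl) a))
    ... | row-body k refl _ _ = refl
    ... | row-after x        = ⊥-elim (ℕP.<-irrefl refl (ℕP.<-≤-trans x b))

    muRow-after : ∀ r → rt < r → muRow r ≡ rowLen lam r
    muRow-after r lt with rowCase r0 rt r r0≤rt
    ... | row-before x       = ⊥-elim (ℕP.<-irrefl refl (ℕP.<-trans x (ℕP.≤-<-trans r0≤rt lt)))
    ... | row-head refl      = ⊥-elim (ℕP.<-irrefl refl (ℕP.≤-<-trans r0≤rt lt))
    ... | row-body k refl a b = ⊥-elim (ℕP.<-irrefl refl (ℕP.<-≤-trans lt b))
    ... | row-after _        = refl

    lam≤muRow : ∀ r → rowLen lam r ≤ muRow r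
    lam≤muRow r with rowCase r0 rt r r0≤rt
    ... | row-before _        = ℕP.≤-refl
    ... | row-head refl       = ℕP.m≤n⇒m≤1+n head-free
    ... | row-body k refl _ _ = ℕP.m≤n⇒m≤1+n (rowLen-suc-≤ Pl k)
    ... | row-after _         = ℕP.≤-refl

    muRow-suc-≤ : ∀ r → muRow (suc r) ≤ muRow r
    muRow-suc-≤ r = go (rowCase r0 rt (suc r) r0≤rt)
      where
      go : RowCase r0 rt (suc r) → muRow (suc r) ≤ muRow r
      go (row-before x) = subst₂ _≤_ (sym (muRow-before (suc r) x)) (sym (muRow-before r (ℕP.<-trans (ℕP.n<1+n r) x)))
                                 (rowLen-suc-≤ Pl r)
      go (row-head e)   = subst₂ _≤_ (sym (trans (cong muRow e) muRow-head)) (sym (muRow-before r (subst (r <_) e (ℕP.n<1+n r))))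
                                 (above-head r e)
      go (row-after x)  = subst (_≤ muRow r) (sym (muRow-after (suc r) x)) (ℕP.≤-trans (rowLen-suc-≤ Pl r) (lam≤muRow r))
      go (row-body k refl a b) with ℕP.m≤n⇒m<n∨m≡n a
      ... | inj₂ refl = subst₂ _≤_ (sym (muRow-body k a b)) (sym muRow-head) (s≤s head-free)
      go (row-body (suc k) refl a b) | inj₁ r0<sk =
        subst₂ _≤_ (sym (muRow-body (suc k) a b)) (sym (muRow-body k (ℕP.≤-pred r0<sk) (ℕP.<-trans (ℕP.n<1+n k) b)))
                   (s≤s (rowLen-suc-≤ Pl k))

    L : ℕ
    L = length lam ℕ.⊔ suc rt

    mu : List ℕ
    mu = applyUpTo muRow L

    rowLen-mu : ∀ r → rowLen mu r ≡ muRow r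
    rowLen-mu r with r <? L
    ... | yes lt = rowLen-applyUpTo< muRow L r lt
    ... | no nlt = trans (rowLen-applyUpTo≥ muRow L r L≤r) (sym (trans
        (muRow-after r (ℕP.≤-trans (ℕP.m≤n⊔m (length lam) (suc rt)) L≤r))
        (rowLen-beyond lam r (ℕP.≤-trans (ℕP.m≤m⊔n (length lam) (suc rt)) L≤r))))
      where
      L≤r : L ≤ r
      L≤r = ℕP.≮⇒≥ nlt

    muRow-pos : ∀ r → r < L → 0 < muRow r
    muRow-pos r lt with rowCase r0 rt r r0≤rt
    ... | row-head _       = s≤s z≤n
    ... | row-body _ _ _ _ = s≤s z≤n
    ... | row-before x = lam-pos r0 refl x
      where
      lam-pos : ∀ m → m ≡ r0 → r < m → 0 < rowLen lam r
      lam-pos (suc k) e r<m = ℕP.<-≤-trans (s≤s z≤n) (ℕP.≤-trans (above-head k e) (rowLen-antitone Pl (ℕP.≤-pred r<m)))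
    muRow-pos r lt | row-after x with r <? length lam
    ... | yes y = rowLen-pos (proj₂ Pl) r y
    ... | no y  = ⊥-elim (ℕP.<-irrefl refl (ℕP.<-≤-trans lt (ℕP.⊔-lub (ℕP.≮⇒≥ y) x)))

    mu-partition : IsPartition mu
    mu-partition = applyUpTo-linked muRow L muRow-suc-≤ , applyUpTo-positive muRow L muRow-pos

    rows : ∀ i → + c0 -ᶻ + r0 ≡ i → RibbonRows n lam mu i
    rows i head-content = record
      { r0 = r0 ; rt = rt ; c0 = c0 ; r0≤rt = r0≤rt ; head-content = head-content
      ; before = λ r lt → trans (rowLen-mu r) (muRow-before r lt)
      ; head = trans (rowLen-mu r0) muRow-head ; head-free = head-free
      ; body = λ r a b → trans (rowLen-mu (suc r)) (muRow-body r a b)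
      ; after = λ r lt → trans (rowLen-mu r) (muRow-after r lt) ; size-condition = size-condition }

  -- Adding an n-ribbon with head on diagonal i moves the bead at src n i up to dst i.
  src : ℕ → ℤ → ℤ
  src n i = i +ᶻ + 1 -ᶻ + n

  dst : ℤ → ℤ
  dst i = i +ᶻ + 1

  dst-sub : ∀ c r → dst (+ c -ᶻ + r) ≡ + suc c -ᶻ + r
  dst-sub c r = trans (solve 2 (λ C R → C :- R :+ con (+ 1) := (C :+ con (+ 1)) :- R) refl (+ c) (+ r))
                      (cong (λ z → + z -ᶻ + r) (ℕP.+-comm c 1))
    where open ℤ-Solver

  src-sub : ∀ n c r → src n (+ c -ᶻ + r) ≡ + suc c -ᶻ + (r + n)
  src-sub n c r = trans (solve 3 (λ C R N → C :- R :+ con (+ 1) :- N := (C :+ con (+ 1)) :- (R :+ N)) refl (+ c) (+ r) (+ n))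
                        (cong (λ z → + z -ᶻ + (r + n)) (ℕP.+-comm c 1))
    where open ℤ-Solver

  indicator : ∀ {A : Set} → Dec A → ℕ
  indicator (yes _) = 1
  indicator (no _)  = 0

  indicator-yes : ∀ {A : Set} (d : Dec A) → A → indicator d ≡ 1
  indicator-yes (yes _) _ = refl
  indicator-yes (no ¬a) a = ⊥-elim (¬a a)

  indicator-no : ∀ {A : Set} (d : Dec A) → ¬ A → indicator d ≡ 0
  indicator-no (yes a) ¬a = ⊥-elim (¬a a)
  indicator-no (no _)  _  = refl

  indicator-⇔ : ∀ {A B : Set} (d : Dec A) (d′ : Dec B) → (A → B) → (B → A) → indicator d ≡ indicator d′
  indicator-⇔ (yes a) (yes b) f g = refl
  indicator-⇔ (yes a) (no nb) f g = ⊥-elim (nb (f a))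
  indicator-⇔ (no na) (yes b) f g = ⊥-elim (na (g b))
  indicator-⇔ (no _)  (no _)  f g = refl

  length-filter-∷ : ∀ {P : Pred ℕ _} (d : Decidable P) x xs →
                    length (filter d (x ∷ xs)) ≡ indicator (d x) + length (filter d xs)
  length-filter-∷ d x xs with d x
  ... | yes _ = refl
  ... | no _  = refl

  length-filter-applyUpTo : ∀ {P : Pred ℕ _} (d : Decidable P) f L →
                            length (filter d (applyUpTo f L)) ≡ sumTo (λ r → indicator (d (f r))) L
  length-filter-applyUpTo d f zero    = refl
  length-filter-applyUpTo d f (suc L) = trans (length-filter-∷ d (f 0) (applyUpTo (λ r → f (suc r)) L))
    (trans (cong (_+_ (indicator (d (f 0)))) (length-filter-applyUpTo d (λ r → f (suc r)) L))
           (sym (sumTo-front (λ r → indicator (d (f r))) L)))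

  between : ℕ → ℤ → ℤ → ℕ
  between n i x = indicator ((src n i ℤ.<? x) ×-dec (x ℤ.<? dst i))

  between-inside : ∀ n i x → src n i <ᶻ x → x <ᶻ dst i → between n i x ≡ 1
  between-inside n i x a b = indicator-yes ((src n i ℤ.<? x) ×-dec (x ℤ.<? dst i)) (a , b)

  between-outside : ∀ n i x → ¬ (src n i <ᶻ x × x <ᶻ dst i) → between n i x ≡ 0
  between-outside n i x = indicator-no ((src n i ℤ.<? x) ×-dec (x ℤ.<? dst i))

  sumβ : (ℤ → ℕ) → List ℕ → ℕ → ℕ
  sumβ f l R = sumTo (λ r → f (β l r)) R

  -- The β-set of μ is that of λ with the bead at src n i moved to dst i; beyond row `bound` the two
  -- partitions agree, so sums over the first R ≥ bound beads see exactly this move.  The spin is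
  -- the number of beads jumped over.
  record BeadMove (n : ℕ) (i : ℤ) (lam mu : List ℕ) : Set where
    field
      src∈      : src n i ∈β lam
      dst∉      : ¬ (dst i ∈β lam)
      from-μ    : ∀ x → x ∈β mu → x ≡ dst i ⊎ (x ∈β lam × x ≢ src n i)
      dst∈      : dst i ∈β mu
      from-λ    : ∀ x → x ∈β lam → x ≢ src n i → x ∈β mu
      bound     : ℕ
      sumβ-move : ∀ f R → bound ≤ R → sumβ f mu R + f (src n i) ≡ sumβ f lam R + f (dst i)
      spin≡     : ∀ R → bound ≤ R → spin lam mu ≡ sumβ (between n i) lam R

  module RowsToBeadMove {n : ℕ} {lam mu : List ℕ} {i : ℤ} (rs : RibbonRows n lam mu i)
                        (Pl : IsPartition lam) (Pm : IsPartition mu) where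
    open RibbonRows rs
    open RowsProperties rs Pl

    i≡ : i ≡ + c0 -ᶻ + r0
    i≡ = sym head-content

    β-head : β mu r0 ≡ dst i
    β-head = trans (cong (λ z → + z -ᶻ + r0) head) (sym (trans (cong dst i≡) (dst-sub c0 r0)))

    β-tail : β lam rt ≡ src n i
    β-tail = trans (sub≡sub⇐ (rowLen lam rt) rt (suc c0) (r0 + n) tail-sum)
                   (sym (trans (cong (src n) i≡) (src-sub n c0 r0)))
      where
      tail-sum : rowLen lam rt + (r0 + n) ≡ suc c0 + rt
      tail-sum = trans (sym (ℕP.+-assoc (rowLen lam rt) r0 n)) (trans size-condition (cong (_+ rt) (ℕP.+-comm c0 1)))

    β-before : ∀ r → r < r0 → β mu r ≡ β lam r
    β-before r lt = cong (λ z → + z -ᶻ + r) (before r lt)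

    β-after : ∀ r → rt < r → β mu r ≡ β lam r
    β-after r lt = cong (λ z → + z -ᶻ + r) (after r lt)

    β-body : ∀ r → r0 ≤ r → r < rt → β mu (suc r) ≡ β lam r
    β-body r a b = trans (cong (λ z → + z -ᶻ + suc r) (body r a b))
                         (sub≡sub⇐ (suc (rowLen lam r)) (suc r) (rowLen lam r) r (sym (ℕP.+-suc (rowLen lam r) r)))

    β<dst : ∀ r → r0 ≤ r → β lam r <ᶻ dst i
    β<dst r le = ℤP.≤-<-trans (β-nonincreasing Pl le)
      (subst (β lam r0 <ᶻ_) (sym (trans (cong dst i≡) (dst-sub c0 r0)))
             (sub<sub⇐ (rowLen lam r0) r0 (suc c0) r0 (ℕP.+-monoˡ-< r0 (s≤s head-free))))

    dst<β : ∀ r → r < r0 → dst i <ᶻ β lam r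
    dst<β r lt = subst₂ _<ᶻ_ β-head (β-before r lt) (β-decreasing Pm lt)

    dst∉ : ¬ (dst i ∈β lam)
    dst∉ (r , e) with ℕP.<-cmp r r0
    ... | tri< lt _ _ = ℤP.<-irrefl (sym e) (dst<β r lt)
    ... | tri≈ _ refl _ = ℤP.<-irrefl e (β<dst r ℕP.≤-refl)
    ... | tri> _ _ gt = ℤP.<-irrefl e (β<dst r (ℕP.<⇒≤ gt))

    kept : ∀ {x} s → β lam s ≡ x → s ≢ rt → x ∈β lam × x ≢ src n i
    kept s e ne = (s , e) , λ e′ → ne (β-injective Pl (trans e (trans e′ (sym β-tail))))

    from-μ : ∀ x → x ∈β mu → x ≡ dst i ⊎ (x ∈β lam × x ≢ src n i)
    from-μ x (r , e) with rowCase r0 rt r r0≤rt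
    ... | row-before lt = inj₂ (kept r (trans (sym (β-before r lt)) e) λ { refl → ℕP.<-irrefl refl (ℕP.<-≤-trans lt r0≤rt) })
    ... | row-head refl = inj₁ (trans (sym e) β-head)
    ... | row-body k refl a b = inj₂ (kept k (trans (sym (β-body k a b)) e) λ { refl → ℕP.<-irrefl refl b })
    ... | row-after lt = inj₂ (kept r (trans (sym (β-after r lt)) e) λ { refl → ℕP.<-irrefl refl lt })

    from-λ : ∀ x → x ∈β lam → x ≢ src n i → x ∈β mu
    from-λ x (r , e) ne with r <? r0
    ... | yes lt = r , trans (β-before r lt) e
    ... | no nlt with ℕP.<-cmp r rt
    ...   | tri< lt _ _ = suc r , trans (β-body r (ℕP.≮⇒≥ nlt) lt) e
    ...   | tri≈ _ refl _ = ⊥-elim (ne (trans (sym e) β-tail))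
    ...   | tri> _ _ gt = r , trans (β-after r gt) e

    sumβ-move : ∀ f R → suc rt ≤ R → sumβ f mu R + f (src n i) ≡ sumβ f lam R + f (dst i)
    sumβ-move f R le = subst₂ (λ a b → sumβ f mu R + a ≡ sumβ f lam R + b) (cong f β-tail) (cong f β-head)
        (trans (sym (ℕP.+-identityʳ _)) (trans (sum-shifted R le) (ℕP.+-identityʳ _)))
      where
      open ShiftedSum (λ r → f (β lam r)) (λ r → f (β mu r)) r0 rt 0 r0≤rt (λ r lt → cong f (β-before r lt))
        (λ r a b → trans (cong f (β-body r a b)) (sym (ℕP.+-identityʳ _))) (λ r lt → cong f (β-after r lt))

    between-count : ∀ R → rt ≤ R → sumβ (between n i) lam R + r0 ≡ rt
    between-count R le = sumTo-indicator (λ r → between n i (β lam r)) r0 rt R r0≤rt le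
      (λ r lt → between-outside n i _ (λ p → ℤP.<-asym (proj₂ p) (dst<β r lt)))
      (λ r a b → between-inside n i _ (subst (_<ᶻ β lam r) β-tail (β-decreasing Pl b)) (β<dst r a))
      (λ r a b → between-outside n i _ (λ p → ℤP.<-irrefl refl (ℤP.<-≤-trans (proj₁ p) (subst (β lam r ≤ᶻ_) β-tail (β-nonincreasing Pl a)))))

    skew-count : sumTo (λ r → indicator (rowLen lam r <? rowLen mu r)) (length mu) + r0 ≡ suc rt
    skew-count = sumTo-indicator _ r0 (suc rt) (length mu) (ℕP.≤-trans r0≤rt (ℕP.n≤1+n rt))
      (skewRow<length {lam} {mu} rt (inside⇒skewRow rt r0≤rt ℕP.≤-refl))
      (λ r lt → indicator-no _ (λ s → ℕP.<-irrefl refl (ℕP.<-≤-trans lt (proj₁ (skewRow⇒inside r s)))))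
      (λ r a b → indicator-yes _ (inside⇒skewRow r a (ℕP.≤-pred b)))
      (λ r a b → indicator-no _ (λ s → ℕP.<-irrefl refl (ℕP.<-≤-trans a (proj₂ (skewRow⇒inside r s)))))

    spin+r0 : spin lam mu + r0 ≡ rt
    spin+r0 = go _ (length-filter-applyUpTo (λ r → rowLen lam r <? rowLen mu r) (λ r → r) (length mu)) skew-count
      where
      go : ∀ s → length (filter (λ r → rowLen lam r <? rowLen mu r) (upTo (length mu))) ≡ s →
           s + r0 ≡ suc rt → spin lam mu + r0 ≡ rt
      go (suc s) e e′ = trans (cong (λ z → z ∸ 1 + r0) e) (ℕP.suc-injective e′)
      go zero    e e′ = ⊥-elim (ℕP.<-irrefl e′ (s≤s r0≤rt))

    beadMove : BeadMove n i lam mu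
    beadMove = record
      { src∈ = rt , β-tail ; dst∉ = dst∉ ; from-μ = from-μ ; dst∈ = r0 , β-head ; from-λ = from-λ
      ; bound = suc rt ; sumβ-move = sumβ-move
      ; spin≡ = λ R le → ℕP.+-cancelʳ-≡ r0 _ _ (trans spin+r0 (sym (between-count R (ℕP.≤-trans (ℕP.n≤1+n rt) le)))) }

  least : (Q : ℕ → Set) → (∀ r → Dec (Q r)) → ∀ N → Q N →
          Σ ℕ (λ r0 → Q r0 × r0 ≤ N × (∀ k → k < r0 → ¬ Q k))
  least Q Q? N qN = go N 0 refl (λ k ())
    where
    go : ∀ f k → k + f ≡ N → (∀ j → j < k → ¬ Q j) → Σ ℕ (λ r0 → Q r0 × r0 ≤ N × (∀ j → j < r0 → ¬ Q j))
    go f k e h with Q? k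
    ... | yes q = k , q , subst (k ≤_) e (ℕP.m≤m+n k f) , h
    go zero    k e h | no nq = ⊥-elim (nq (subst Q (sym (trans (sym (ℕP.+-identityʳ k)) e)) qN))
    go (suc f) k e h | no nq = go f (suc k) (trans (sym (ℕP.+-suc k f)) e) h′
      where
      h′ : ∀ j → j < suc k → ¬ Q j
      h′ j lt with ℕP.m≤n⇒m<n∨m≡n (ℕP.≤-pred lt)
      ... | inj₁ x    = h j x
      ... | inj₂ refl = nq

  β-eventually-≤ : ∀ {l} → IsPartition l → ∀ x → Σ ℕ (λ N → β l N ≤ᶻ x)
  β-eventually-≤ {l} P x with ℤ≡sub x
  ... | a , b , refl = N , sub≤sub⇐ (rowLen l N) N a b
    (ℕP.≤-trans (ℕP.+-monoˡ-≤ b (rowLen-antitone P z≤n)) (ℕP.m≤n+m N a))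
    where
    N : ℕ
    N = rowLen l 0 + b

  ∈β? : ∀ {l} → IsPartition l → ∀ x → Dec (x ∈β l)
  ∈β? {l} P x with β-eventually-≤ P x
  ... | N , le with least (λ r → β l r ≤ᶻ x) (λ r → β l r ℤ.≤? x) N le
  ...   | r0 , q , _ , h with β l r0 ℤ.≟ x
  ...     | yes e = yes (r0 , e)
  ...     | no ne = no λ { (r , e) → not-bead r e }
    where
    not-bead : ∀ r → β l r ≢ x
    not-bead r e with ℕP.<-cmp r r0
    ... | tri< lt _ _ = h r lt (ℤP.≤-reflexive e)
    ... | tri≈ _ refl _ = ne e
    ... | tri> _ _ gt = ℤP.<-irrefl refl (ℤP.<-≤-trans (subst (_<ᶻ β l r0) e (β-decreasing P gt)) q)

  -- The head row r0 is the first row whose bead lies at or below the head content a - b,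
  -- and the tail row rt is the row of the bead at src n i.
  module ExistsRibbon (n : ℕ) {lam : List ℕ} (Pl : IsPartition lam) (a b rt : ℕ)
    (β-rt : β lam rt ≡ src n (+ a -ᶻ + b)) (dst∉ : ¬ (dst (+ a -ᶻ + b) ∈β lam))
    (r0 : ℕ) (β-r0 : β lam r0 ≤ᶻ + a -ᶻ + b) (r0≤rt : r0 ≤ rt)
    (r0-least : ∀ k → k < r0 → ¬ (β lam k ≤ᶻ + a -ᶻ + b)) where

    i : ℤ
    i = + a -ᶻ + b

    r0-bound : rowLen lam r0 + b ≤ a + r0
    r0-bound = sub≤sub⇒ (rowLen lam r0) r0 a b β-r0

    c0 : ℕ
    c0 = a + r0 ∸ b

    c0+b : c0 + b ≡ a + r0
    c0+b = ℕP.m∸n+n≡m (ℕP.≤-trans (ℕP.m≤n+m b (rowLen lam r0)) r0-bound)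

    head-content : + c0 -ᶻ + r0 ≡ i
    head-content = sub≡sub⇐ c0 r0 a b c0+b

    head-free : rowLen lam r0 ≤ c0
    head-free = ℕP.+-cancelʳ-≤ b _ _ (subst (rowLen lam r0 + b ≤_) (sym c0+b) r0-bound)

    above-head : ∀ k → suc k ≡ r0 → suc c0 ≤ rowLen lam k
    above-head k e with ℕP.<-cmp c0 (rowLen lam k)
    ... | tri< lt _ _ = lt
    ... | tri≈ _ ce _ = ⊥-elim (dst∉ (k , trans (cong (λ z → + z -ᶻ + k) (sym ce))
            (sym (trans (cong dst (sym head-content))
                        (trans (dst-sub c0 r0) (sub≡sub⇐ (suc c0) r0 c0 k (trans (sym (ℕP.+-suc c0 k)) (cong (_+_ c0) e))))))))
    ... | tri> _ _ gt = ⊥-elim (r0-least k (subst (k <_) e ℕP.≤-refl) (sub≤sub⇐ (rowLen lam k) k a b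
            (ℕP.≤-pred (subst (rowLen lam k + b <_) (trans c0+b (trans (cong (_+_ a) (sym e)) (ℕP.+-suc a k)))
                               (ℕP.+-monoˡ-< b gt)))))

    size-condition : rowLen lam rt + r0 + n ≡ c0 + 1 + rt
    size-condition = trans (ℕP.+-assoc (rowLen lam rt) r0 n)
      (trans (sub≡sub⇒ (rowLen lam rt) rt (suc c0) (r0 + n) (trans β-rt (trans (cong (src n) (sym head-content)) (src-sub n c0 r0))))
             (cong (_+ rt) (ℕP.+-comm 1 c0)))

    open BuildRibbon n lam Pl r0 rt c0 r0≤rt head-free above-head size-condition public
      using (mu; mu-partition)

    ribbon : IsRibbonAdd n lam mu i
    ribbon = RowsRibbon.ribbon (BuildRibbon.rows n lam Pl r0 rt c0 r0≤rt head-free above-head size-condition i head-content)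
                               Pl mu-partition

  src≤ : ∀ {n} i → 1 ≤ n → src n i ≤ᶻ i
  src≤ {n} i n≥1 = begin
    i +ᶻ + 1 -ᶻ + n     ≡⟨ solve 2 (λ I N → I :+ con (+ 1) :- N := I :+ (con (+ 1) :- N)) refl i (+ n) ⟩
    i +ᶻ (+ 1 -ᶻ + n)   ≤⟨ ℤP.+-monoʳ-≤ i (sub≤sub⇐ 1 n 0 0 (subst (_≤ n) (sym (ℕP.+-identityʳ 1)) n≥1)) ⟩
    i +ᶻ (+ 0 -ᶻ + 0)   ≡⟨ ℤP.+-identityʳ i ⟩
    i                   ∎
    where
    open ℤP.≤-Reasoning
    open ℤ-Solver

  ribbon-exists : ∀ n → 1 ≤ n → ∀ {lam} → IsPartition lam → ∀ i → src n i ∈β lam → ¬ (dst i ∈β lam) →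
                  Σ (List ℕ) (λ mu → IsRibbonAdd n lam mu i)
  ribbon-exists n n≥1 {lam} Pl i (rt , β-rt) dst∉ with ℤ≡sub i
  ... | a , b , refl with least (λ r → β lam r ≤ᶻ + a -ᶻ + b) (λ r → β lam r ℤ.≤? (+ a -ᶻ + b)) rt
                                (subst (_≤ᶻ _) (sym β-rt) (src≤ (+ a -ᶻ + b) n≥1))
  ...   | r0 , β-r0 , r0≤rt , r0-least = mu , ribbon
    where open ExistsRibbon n Pl a b rt β-rt dst∉ r0 β-r0 r0≤rt r0-least

  ribbon⇒BeadMove : ∀ {n i lam mu} → IsPartition lam → IsRibbonAdd n lam mu i → BeadMove n i lam mu
  ribbon⇒BeadMove Pl rib = RowsToBeadMove.beadMove (ribbonRows Pl rib) Pl (proj₁ rib)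

  Addable : ℕ → ℤ → List ℕ → Set
  Addable n i l = src n i ∈β l × ¬ (dst i ∈β l)

  Addable? : ∀ n i {l} → IsPartition l → Dec (Addable n i l)
  Addable? n i P with ∈β? P (src n i) | ∈β? P (dst i)
  ... | yes a | no b  = yes (a , b)
  ... | yes a | yes b = no (λ c → proj₂ c b)
  ... | no a  | _     = no (λ c → a (proj₁ c))

  BeadMove⇒Addable : ∀ {n i l m} → BeadMove n i l m → Addable n i l
  BeadMove⇒Addable mv = BeadMove.src∈ mv , BeadMove.dst∉ mv

  data UView (n : ℕ) (i : ℤ) (l : List ℕ) : Res → Set where
    no-ribbon : ¬ Addable n i l → UView n i l nothing
    ribbon-at : ∀ m → IsPartition m → BeadMove n i l m → UView n i l (just (+ spin l m , m))

  U-view : ∀ {n i l x} → 1 ≤ n → IsPartition l → U n i l x → UView n i l x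
  U-view n≥1 Pl (hit m rib) = ribbon-at m (proj₁ rib) (ribbon⇒BeadMove Pl rib)
  U-view {n} {i} n≥1 Pl (miss none) = no-ribbon λ { (src∈ , dst∉) →
    let (mu , rib) = ribbon-exists n n≥1 Pl i src∈ dst∉ in none mu rib }

  U-total : ∀ n i {l} → 1 ≤ n → IsPartition l → Σ Res (U n i l)
  U-total n i n≥1 Pl with Addable? n i Pl
  ... | yes (src∈ , dst∉) = _ , hit _ (proj₂ (ribbon-exists n n≥1 Pl i src∈ dst∉))
  ... | no ¬addable       = nothing , miss (λ m rib → ¬addable (BeadMove⇒Addable (ribbon⇒BeadMove Pl rib)))

  BeadMove-unique : ∀ {n i l m m′} → IsPartition m → IsPartition m′ → BeadMove n i l m → BeadMove n i l m′ → m ≡ m′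
  BeadMove-unique Pm Pm′ mv mv′ = β-ext Pm Pm′ (⊆ mv mv′) (⊆ mv′ mv)
    where
    ⊆ : ∀ {n i l m m′} → BeadMove n i l m → BeadMove n i l m′ → ∀ x → x ∈β m → x ∈β m′
    ⊆ mv mv′ x xm with BeadMove.from-μ mv x xm
    ... | inj₁ refl      = BeadMove.dst∈ mv′
    ... | inj₂ (xl , ne) = BeadMove.from-λ mv′ x xl ne

  BeadMove-injective : ∀ {n i l l′ m} → IsPartition l → IsPartition l′ → BeadMove n i l m → BeadMove n i l′ m → l ≡ l′
  BeadMove-injective Pl Pl′ mv mv′ = β-ext Pl Pl′ (⊆ mv mv′) (⊆ mv′ mv)
    where
    ⊆ : ∀ {n i l l′ m} → BeadMove n i l m → BeadMove n i l′ m → ∀ x → x ∈β l → x ∈β l′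
    ⊆ {n} {i} mv mv′ x xl with x ℤ.≟ src n i
    ... | yes refl = BeadMove.src∈ mv′
    ... | no ne with BeadMove.from-μ mv′ x (BeadMove.from-λ mv x xl ne)
    ...   | inj₁ refl      = ⊥-elim (BeadMove.dst∉ mv xl)
    ...   | inj₂ (xl′ , _) = xl′

  U-functional : ∀ {n i l x y} → 1 ≤ n → IsPartition l → U n i l x → U n i l y → x ≡ y
  U-functional n≥1 Pl u v with U-view n≥1 Pl u | U-view n≥1 Pl v
  ... | no-ribbon _       | no-ribbon _         = refl
  ... | no-ribbon nc      | ribbon-at _ _ mv    = ⊥-elim (nc (BeadMove⇒Addable mv))
  ... | ribbon-at _ _ mv  | no-ribbon nc        = ⊥-elim (nc (BeadMove⇒Addable mv))
  ... | ribbon-at m Pm mv | ribbon-at m′ Pm′ mv′ with BeadMove-unique Pm Pm′ mv mv′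
  ...   | refl = refl

  Valid : Res → Set
  Valid nothing        = ⊤
  Valid (just (e , l)) = IsPartition l

  scale-+ : ∀ d e x → scale d (scale e x) ≡ scale (d +ᶻ e) x
  scale-+ d e nothing        = refl
  scale-+ d e (just (f , l)) = cong (λ z → just (z , l)) (sym (ℤP.+-assoc d e f))

  scale-0 : ∀ x → scale (+ 0) x ≡ x
  scale-0 nothing        = refl
  scale-0 (just (f , l)) = cong (λ z → just (z , l)) (ℤP.+-identityˡ f)

  scale-valid : ∀ d x → Valid x → Valid (scale d x)
  scale-valid d nothing  g = tt
  scale-valid d (just _) g = g

  U-valid : ∀ {n i l x} → U n i l x → Valid x
  U-valid (hit m rib) = proj₁ rib
  U-valid (miss _)    = tt

  Apply-valid : ∀ {n i x z} → Apply n i x z → Valid z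
  Apply-valid app0             = tt
  Apply-valid (appj {e = e} u) = scale-valid e _ (U-valid u)

  Act-valid : ∀ {n w x z} → Valid x → Act n w x z → Valid z
  Act-valid g nil         = g
  Act-valid g (cons a ap) = Apply-valid ap

  Apply-total : ∀ n i x → 1 ≤ n → Valid x → Σ Res (Apply n i x)
  Apply-total n i nothing        n≥1 g = nothing , app0
  Apply-total n i (just (e , l)) n≥1 g = _ , appj (proj₂ (U-total n i n≥1 g))

  Act-total : ∀ n w x → 1 ≤ n → Valid x → Σ Res (Act n w x)
  Act-total n []      x n≥1 g = x , nil
  Act-total n (i ∷ w) x n≥1 g with Act-total n w x n≥1 g
  ... | y , a with Apply-total n i y n≥1 (Act-valid g a)
  ...   | z , ap = z , cons a ap

  Apply-scale : ∀ {n i x x′ z z′} d → 1 ≤ n → Apply n i x z → Apply n i x′ z′ → x ≡ scale d x′ → Valid x′ →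
                z ≡ scale d z′
  Apply-scale d n≥1 app0     app0      e  g = refl
  Apply-scale {x′ = just (e′ , l′)} d n≥1 (appj {e = e} u) (appj u′) refl g with U-functional n≥1 g u u′
  ... | refl = sym (scale-+ d e′ _)

  Act-scale : ∀ {n w x x′ z z′} d → 1 ≤ n → Act n w x z → Act n w x′ z′ → x ≡ scale d x′ → Valid x′ →
              z ≡ scale d z′
  Act-scale d n≥1 nil         nil           e g = e
  Act-scale d n≥1 (cons a ap) (cons a′ ap′) e g = Apply-scale d n≥1 ap ap′ (Act-scale d n≥1 a a′ e g) (Act-valid g a′)

  Apply-zero : ∀ {n i y} → Apply n i nothing y → y ≡ nothing
  Apply-zero app0 = refl

  Act-zero : ∀ {n w z} → Act n w nothing z → z ≡ nothing
  Act-zero nil = refl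
  Act-zero (cons a ap) rewrite Act-zero a = Apply-zero ap

  Act-++ : ∀ {n} a c {x z} → Act n (a ++ c) x z → Σ Res (λ y → Act n c x y × Act n a y z)
  Act-++ []      c act = _ , act , nil
  Act-++ (i ∷ a) c (cons act ap) with Act-++ a c act
  ... | y , p , q = y , p , cons q ap

  record Independent (n : ℕ) (i j : ℤ) : Set where
    field
      src≢src : src n j ≢ src n i
      dst≢dst : dst j ≢ dst i
      dst≢src : dst j ≢ src n i
      src≢dst : src n j ≢ dst i

  Independent-sym : ∀ {n i j} → Independent n i j → Independent n j i
  Independent-sym ind = record
    { src≢src = λ e → src≢src (sym e) ; dst≢dst = λ e → dst≢dst (sym e)
    ; dst≢src = λ e → src≢dst (sym e) ; src≢dst = λ e → dst≢src (sym e) }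
    where open Independent ind

  Addable-after : ∀ {n i j l m} → Independent n i j → BeadMove n i l m → Addable n j l → Addable n j m
  Addable-after {n} {i} {j} {l} {m} ind mv (src∈ , dst∉) = BeadMove.from-λ mv _ src∈ (Independent.src≢src ind) , not-dst
    where
    not-dst : ¬ (dst j ∈β m)
    not-dst d∈ with BeadMove.from-μ mv _ d∈
    ... | inj₁ e        = Independent.dst≢dst ind e
    ... | inj₂ (d∈ , _) = dst∉ d∈

  Addable-before : ∀ {n i j l m} → Independent n i j → BeadMove n i l m → Addable n j m → Addable n j l
  Addable-before {n} {i} {j} {l} {m} ind mv (src∈ , dst∉) = src∈l , λ d∈ → dst∉ (BeadMove.from-λ mv _ d∈ (Independent.dst≢src ind))
    where
    src∈l : src n j ∈β l
    src∈l with BeadMove.from-μ mv _ src∈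
    ... | inj₁ e        = ⊥-elim (Independent.src≢dst ind e)
    ... | inj₂ (s∈ , _) = s∈

  two-moves-⊆ : ∀ {n i j l m1 m2 nu nu′} → Independent n i j →
    BeadMove n j l m1 → BeadMove n i m1 nu → BeadMove n i l m2 → BeadMove n j m2 nu′ → ∀ x → x ∈β nu → x ∈β nu′
  two-moves-⊆ ind mj mi mi′ mj′ x x∈ with BeadMove.from-μ mi x x∈
  ... | inj₁ refl = BeadMove.from-λ mj′ _ (BeadMove.dst∈ mi′) (λ e → Independent.src≢dst ind (sym e))
  ... | inj₂ (x∈m1 , x≢si) with BeadMove.from-μ mj x x∈m1
  ...   | inj₁ refl         = BeadMove.dst∈ mj′
  ...   | inj₂ (x∈l , x≢sj) = BeadMove.from-λ mj′ x (BeadMove.from-λ mi′ x x∈l x≢si) x≢sj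

  -- Stated with every term on the side where it is added, so that no subtraction occurs.
  spin-arith : ∀ s1 s2 t1 t2 A B C D δ → s2 + A ≡ t1 + B → t2 + C ≡ s1 + D → B + C ≡ A + D + δ →
               s1 + s2 ≡ δ + (t1 + t2)
  spin-arith s1 s2 t1 t2 A B C D δ e1 e2 e3 = ℕP.+-cancelʳ-≡ (A + C) _ _ (begin
    s1 + s2 + (A + C)     ≡⟨ solve 4 (λ s1 s2 A C → s1 :+ s2 :+ (A :+ C) := s1 :+ (s2 :+ A) :+ C) refl s1 s2 A C ⟩
    s1 + (s2 + A) + C     ≡⟨ cong (λ z → s1 + z + C) e1 ⟩
    s1 + (t1 + B) + C     ≡⟨ solve 4 (λ s1 t1 B C → s1 :+ (t1 :+ B) :+ C := s1 :+ t1 :+ (B :+ C)) refl s1 t1 B C ⟩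
    s1 + t1 + (B + C)     ≡⟨ cong (_+_ (s1 + t1)) e3 ⟩
    s1 + t1 + (A + D + δ) ≡⟨ solve 5 (λ s1 t1 A D δ → s1 :+ t1 :+ (A :+ D :+ δ) := δ :+ t1 :+ A :+ (s1 :+ D)) refl s1 t1 A D δ ⟩
    δ + t1 + A + (s1 + D) ≡⟨ cong (_+_ (δ + t1 + A)) (sym e2) ⟩
    δ + t1 + A + (t2 + C) ≡⟨ solve 5 (λ δ t1 A t2 C → δ :+ t1 :+ A :+ (t2 :+ C) := δ :+ (t1 :+ t2) :+ (A :+ C)) refl δ t1 A t2 C ⟩
    δ + (t1 + t2) + (A + C) ∎)
    where
    open ≡-Reasoning
    open ℕ-Solver

  -- Each spin is a count sumβ (between _ _) of beads jumped over, and each move changes the count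
  -- for the other move only at its own two bead positions.
  spins-commute : ∀ {n i j l m1 m2 nu} δ →
    between n i (dst j) + between n j (src n i) ≡ between n i (src n j) + between n j (dst i) + δ →
    BeadMove n j l m1 → BeadMove n i m1 nu → BeadMove n i l m2 → BeadMove n j m2 nu →
    spin l m1 + spin m1 nu ≡ δ + (spin l m2 + spin m2 nu)
  spins-commute {n} {i} {j} {l} {m1} {m2} {nu} δ H mv1 mvA mv2 mvB =
    spin-arith (spin l m1) (spin m1 nu) (spin l m2) (spin m2 nu) _ _ _ _ δ e1 e2 H
    where
    R : ℕ
    R = BeadMove.bound mv1 + BeadMove.bound mvA + BeadMove.bound mv2 + BeadMove.bound mvB
    l1 : BeadMove.bound mv1 ≤ R
    l1 = ℕP.≤-trans (ℕP.m≤m+n _ _) (ℕP.≤-trans (ℕP.m≤m+n _ _) (ℕP.m≤m+n _ _))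
    lA : BeadMove.bound mvA ≤ R
    lA = ℕP.≤-trans (ℕP.m≤n+m _ (BeadMove.bound mv1)) (ℕP.≤-trans (ℕP.m≤m+n _ _) (ℕP.m≤m+n _ _))
    l2 : BeadMove.bound mv2 ≤ R
    l2 = ℕP.≤-trans (ℕP.m≤n+m _ (BeadMove.bound mv1 + BeadMove.bound mvA)) (ℕP.m≤m+n _ _)
    lB : BeadMove.bound mvB ≤ R
    lB = ℕP.m≤n+m _ _
    e1 : spin m1 nu + between n i (src n j) ≡ spin l m2 + between n i (dst j)
    e1 = trans (cong (_+ between n i (src n j)) (BeadMove.spin≡ mvA R lA))
        (trans (BeadMove.sumβ-move mv1 (between n i) R l1) (cong (_+ between n i (dst j)) (sym (BeadMove.spin≡ mv2 R l2))))
    e2 : spin m2 nu + between n j (src n i) ≡ spin l m1 + between n j (dst i)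
    e2 = trans (cong (_+ between n j (src n i)) (BeadMove.spin≡ mvB R lB))
        (trans (BeadMove.sumβ-move mv2 (between n j) R l2) (cong (_+ between n j (dst i)) (sym (BeadMove.spin≡ mv1 R l1))))

  record Commutes (n : ℕ) (i j d : ℤ) : Set where
    field
      commute : ∀ {l y1 z1 y2 z2} → IsPartition l →
                U n j l y1 → Apply n i y1 z1 → U n i l y2 → Apply n j y2 z2 → z1 ≡ scale d z2

  independent-commute : ∀ {n} → 1 ≤ n → ∀ {i j} → Independent n i j → ∀ δ →
    between n i (dst j) + between n j (src n i) ≡ between n i (src n j) + between n j (dst i) + δ →
    Commutes n i j (+ δ)
  independent-commute {n} n≥1 {i} {j} ind δ H = record { commute = commute }
    where
    ind′ : Independent n j i
    ind′ = Independent-sym ind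

    both : ∀ {l m1 m2 nu nu′} → IsPartition nu → IsPartition nu′ →
      BeadMove n j l m1 → BeadMove n i m1 nu → BeadMove n i l m2 → BeadMove n j m2 nu′ →
      just (+ spin l m1 +ᶻ + spin m1 nu , nu) ≡ scale (+ δ) (just (+ spin l m2 +ᶻ + spin m2 nu′ , nu′))
    both {nu = nu} Pn Pn′ mv1 mvA mv2 mvB
      with β-ext Pn Pn′ (two-moves-⊆ ind mv1 mvA mv2 mvB) (two-moves-⊆ ind′ mv2 mvB mv1 mvA)
    ... | refl = cong (λ z → just (+ z , nu)) (spins-commute δ H mv1 mvA mv2 mvB)

    commute : ∀ {l y1 z1 y2 z2} → IsPartition l → U n j l y1 → Apply n i y1 z1 → U n i l y2 → Apply n j y2 z2 →
              z1 ≡ scale (+ δ) z2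
    commute Pl u1 ap1 u2 ap2 with U-view n≥1 Pl u1 | U-view n≥1 Pl u2
    commute Pl u1 app0 u2 app0 | no-ribbon _ | no-ribbon _ = refl
    commute Pl u1 app0 u2 (appj u) | no-ribbon ¬j | ribbon-at m2 Pm2 mv2 with U-view n≥1 Pm2 u
    ... | no-ribbon _       = refl
    ... | ribbon-at _ _ mvB = ⊥-elim (¬j (Addable-before ind mv2 (BeadMove⇒Addable mvB)))
    commute Pl u1 (appj u) u2 app0 | ribbon-at m1 Pm1 mv1 | no-ribbon ¬i with U-view n≥1 Pm1 u
    ... | no-ribbon _       = refl
    ... | ribbon-at _ _ mvA = ⊥-elim (¬i (Addable-before ind′ mv1 (BeadMove⇒Addable mvA)))
    commute Pl u1 (appj u) u2 (appj u′) | ribbon-at m1 Pm1 mv1 | ribbon-at m2 Pm2 mv2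
      with U-view n≥1 Pm1 u | U-view n≥1 Pm2 u′
    ... | no-ribbon ¬i        | _                    = ⊥-elim (¬i (Addable-after ind′ mv1 (BeadMove⇒Addable mv2)))
    ... | ribbon-at _ _ _     | no-ribbon ¬j         = ⊥-elim (¬j (Addable-after ind mv2 (BeadMove⇒Addable mv1)))
    ... | ribbon-at nu Pn mvA | ribbon-at nu′ Pn′ mvB = both Pn Pn′ mv1 mvA mv2 mvB

  -- A common scale for comparing the positions src and dst of two moves at x and x + k.
  offset : ℤ → ℕ → ℕ → ℤ
  offset x u v = x +ᶻ (+ u -ᶻ + v)

  offset-strip : ∀ x A → - x +ᶻ (x +ᶻ A) ≡ A
  offset-strip x A = solve 2 (λ X A → :- X :+ (X :+ A) := A) refl x A
    where open ℤ-Solver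

  offset-≡⇒ : ∀ x u v u′ v′ → offset x u v ≡ offset x u′ v′ → u + v′ ≡ u′ + v
  offset-≡⇒ x u v u′ v′ e =
    sub≡sub⇒ u v u′ v′ (trans (sym (offset-strip x _)) (trans (cong (λ z → - x +ᶻ z) e) (offset-strip x _)))

  offset-≢ : ∀ x u v u′ v′ → u + v′ ≢ u′ + v → offset x u v ≢ offset x u′ v′
  offset-≢ x u v u′ v′ ne e = ne (offset-≡⇒ x u v u′ v′ e)

  offset-<⇒ : ∀ x u v u′ v′ → offset x u v <ᶻ offset x u′ v′ → u + v′ < u′ + v
  offset-<⇒ x u v u′ v′ lt =
    sub<sub⇒ u v u′ v′ (subst₂ _<ᶻ_ (offset-strip x _) (offset-strip x _) (ℤP.+-monoʳ-< (- x) lt))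

  offset-<⇐ : ∀ x u v u′ v′ → u + v′ < u′ + v → offset x u v <ᶻ offset x u′ v′
  offset-<⇐ x u v u′ v′ lt = ℤP.+-monoʳ-< x (sub<sub⇐ u v u′ v′ lt)

  dst-offset : ∀ x k → dst (x +ᶻ + k) ≡ offset x (1 + k) 0
  dst-offset x k = solve 2 (λ X K → X :+ K :+ con (+ 1) := X :+ ((con (+ 1) :+ K) :- con (+ 0))) refl x (+ k)
    where open ℤ-Solver

  src-offset : ∀ n x k → src n (x +ᶻ + k) ≡ offset x (1 + k) n
  src-offset n x k = solve 3 (λ X K N → X :+ K :+ con (+ 1) :- N := X :+ ((con (+ 1) :+ K) :- N)) refl x (+ k) (+ n)
    where open ℤ-Solver

  dst-offset₀ : ∀ x → dst x ≡ offset x 1 0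
  dst-offset₀ x = solve 1 (λ X → X :+ con (+ 1) := X :+ (con (+ 1) :- con (+ 0))) refl x
    where open ℤ-Solver

  src-offset₀ : ∀ n x → src n x ≡ offset x 1 n
  src-offset₀ n x = solve 2 (λ X N → X :+ con (+ 1) :- N := X :+ (con (+ 1) :- N)) refl x (+ n)
    where open ℤ-Solver

  module CommuteAt (n : ℕ) (n≥1 : 1 ≤ n) (x : ℤ) (k : ℕ) (k≥1 : 1 ≤ k) (k≢n : k ≢ n) where
    private
      i j : ℤ
      i = x +ᶻ + k
      j = x

      sj : src n j ≡ offset x 1 n
      sj = src-offset₀ n x
      dj : dst j ≡ offset x 1 0
      dj = dst-offset₀ x
      si : src n i ≡ offset x (1 + k) n
      si = src-offset n x k
      di : dst i ≡ offset x (1 + k) 0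
      di = dst-offset x k

      k+0 : k + 0 ≡ k
      k+0 = ℕP.+-identityʳ k

      n<k+n : n < k + n
      n<k+n = ℕP.m<n+m n k≥1

      ind : Independent n i j
      ind = record
        { src≢src = λ e → offset-≢ x 1 n (1 + k) n (λ q → ℕP.<-irrefl (ℕP.suc-injective q) n<k+n) (trans (sym sj) (trans e si))
        ; dst≢dst = λ e → offset-≢ x 1 0 (1 + k) 0 (λ q → ℕP.<-irrefl (trans (ℕP.suc-injective q) k+0) k≥1) (trans (sym dj) (trans e di))
        ; dst≢src = λ e → offset-≢ x 1 0 (1 + k) n (λ q → k≢n (sym (trans (ℕP.suc-injective q) k+0))) (trans (sym dj) (trans e si))
        ; src≢dst = λ e → offset-≢ x 1 n (1 + k) 0 (λ q → ℕP.<-irrefl (ℕP.suc-injective q) (ℕP.<-≤-trans k≥1 (ℕP.m≤m+n k n)))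
                                   (trans (sym sj) (trans e di)) }

      si<dj : k < n → src n i <ᶻ dst j
      si<dj lt = subst₂ _<ᶻ_ (sym si) (sym dj) (offset-<⇐ x (1 + k) n 1 0 (s≤s (subst (_< n) (sym k+0) lt)))
      si≮dj : ¬ (k < n) → ¬ (src n i <ᶻ dst j)
      si≮dj nlt lt = nlt (subst (_< n) k+0 (ℕP.≤-pred (offset-<⇒ x (1 + k) n 1 0 (subst₂ _<ᶻ_ si dj lt))))
      dj<di : dst j <ᶻ dst i
      dj<di = subst₂ _<ᶻ_ (sym dj) (sym di) (offset-<⇐ x 1 0 (1 + k) 0 (s≤s (subst (0 <_) (sym k+0) k≥1)))
      sj<si : src n j <ᶻ src n i
      sj<si = subst₂ _<ᶻ_ (sym sj) (sym si) (offset-<⇐ x 1 n (1 + k) n (s≤s n<k+n))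
      si≮sj : ¬ (src n i <ᶻ src n j)
      si≮sj lt = ℕP.<-irrefl refl (ℕP.<-trans n<k+n (ℕP.≤-pred (offset-<⇒ x (1 + k) n 1 n (subst₂ _<ᶻ_ si sj lt))))
      di≮dj : ¬ (dst i <ᶻ dst j)
      di≮dj lt with offset-<⇒ x (1 + k) 0 1 0 (subst₂ _<ᶻ_ di dj lt)
      ... | s≤s ()

      between-i-sj : between n i (src n j) ≡ 0
      between-i-sj = between-outside n i _ (si≮sj ∘ proj₁)
      between-j-di : between n j (dst i) ≡ 0
      between-j-di = between-outside n j _ (di≮dj ∘ proj₂)

    -- For k < n each move jumps over the other's bead, which gives the factor q².
    commutes-near : k < n → Commutes n i j (+ 2)
    commutes-near lt = independent-commute n≥1 ind 2 (begin
      between n i (dst j) + between n j (src n i)                ≡⟨ cong₂ _+_ (between-inside n i _ (si<dj lt) dj<di) (between-inside n j _ sj<si (si<dj lt)) ⟩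
      2                                                          ≡⟨ cong₂ (λ a b → a + b + 2) (sym between-i-sj) (sym between-j-di) ⟩
      between n i (src n j) + between n j (dst i) + 2            ∎)
      where open ≡-Reasoning

    commutes-far : ¬ (k < n) → Commutes n i j (+ 0)
    commutes-far nlt = independent-commute n≥1 ind 0 (begin
      between n i (dst j) + between n j (src n i)                ≡⟨ cong₂ _+_ (between-outside n i _ (si≮dj nlt ∘ proj₁)) (between-outside n j _ (si≮dj nlt ∘ proj₂)) ⟩
      0                                                          ≡⟨ cong₂ (λ a b → a + b + 0) (sym between-i-sj) (sym between-j-di) ⟩
      between n i (src n j) + between n j (dst i) + 0            ∎)
      where open ≡-Reasoning

  data ApplyView (n : ℕ) (i : ℤ) : Res → Res → Set where
    vanishes : ∀ {w} → ApplyView n i w nothing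
    moves    : ∀ e l m → IsPartition m → BeadMove n i l m → ApplyView n i (just (e , l)) (just (e +ᶻ + spin l m , m))

  apply-view : ∀ {n i w y} → 1 ≤ n → Valid w → Apply n i w y → ApplyView n i w y
  apply-view n≥1 g app0 = vanishes
  apply-view n≥1 g (appj {e = e} {λ′ = l} u) with U-view n≥1 g u
  ... | no-ribbon _       = vanishes
  ... | ribbon-at m Pm mv = moves e l m Pm mv

  src≢dst : ∀ n i → 1 ≤ n → src n i ≢ dst i
  src≢dst n i n≥1 e = offset-≢ i 1 n 1 0 (λ q → ℕP.<-irrefl (ℕP.suc-injective q) n≥1)
                                     (trans (sym (src-offset₀ n i)) (trans e (dst-offset₀ i)))

  dst+n≢src : ∀ n i → 1 ≤ n → dst (i +ᶻ + n) ≢ src n i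
  dst+n≢src n i n≥1 e = offset-≢ i (1 + n) 0 1 n (λ q → ℕP.<-irrefl (sym (ℕP.suc-injective q)) (ℕP.<-≤-trans n≥1 (ℕP.m≤m+n n n)))
                                     (trans (sym (dst-offset i n)) (trans e (src-offset₀ n i)))

  src∉ : ∀ {n i l m} → 1 ≤ n → BeadMove n i l m → ¬ (src n i ∈β m)
  src∉ {n} {i} n≥1 mv s with BeadMove.from-μ mv _ s
  ... | inj₁ e        = src≢dst n i n≥1 e
  ... | inj₂ (_ , ne) = ne refl

  R2-holds : ∀ {n i w y1 y2} → 1 ≤ n → Valid w → Apply n i w y1 → Apply n i y1 y2 → y2 ≡ nothing
  R2-holds n≥1 g ap1 ap2 with apply-view n≥1 g ap1
  ... | vanishes = Apply-zero ap2
  ... | moves _ _ _ Pm mv with apply-view n≥1 Pm ap2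
  ...   | vanishes            = refl
  ...   | moves _ _ _ _ mv′ = ⊥-elim (src∉ n≥1 mv (BeadMove.src∈ mv′))

  -- The bead put at dst (i + n) by the first move blocks the third.
  R3-holds : ∀ {n i w y1 y2 y3} → 1 ≤ n → Valid w →
    Apply n (i +ᶻ + n) w y1 → Apply n i y1 y2 → Apply n (i +ᶻ + n) y2 y3 → y3 ≡ nothing
  R3-holds {n} {i} n≥1 g ap1 ap2 ap3 with apply-view n≥1 g ap1
  ... | vanishes = Apply-zero (subst (λ z → Apply n (i +ᶻ + n) z _) (Apply-zero ap2) ap3)
  ... | moves _ _ _ P1 mv1 with apply-view n≥1 P1 ap2
  ...   | vanishes = Apply-zero ap3
  ...   | moves _ _ _ P2 mv2 with apply-view n≥1 P2 ap3
  ...     | vanishes = refl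
  ...     | moves _ _ _ _ mv3 =
    ⊥-elim (BeadMove.dst∉ mv3 (BeadMove.from-λ mv2 _ (BeadMove.dst∈ mv1) (dst+n≢src n i n≥1)))

  -- The bead at src n i, removed by the first move, is not restored by the second.
  R4-holds : ∀ {n i w y1 y2 y3} → 1 ≤ n → Valid w →
    Apply n i w y1 → Apply n (i +ᶻ + n) y1 y2 → Apply n i y2 y3 → y3 ≡ nothing
  R4-holds {n} {i} n≥1 g ap1 ap2 ap3 with apply-view n≥1 g ap1
  ... | vanishes = Apply-zero (subst (λ z → Apply n i z _) (Apply-zero ap2) ap3)
  ... | moves _ _ _ P1 mv1 with apply-view n≥1 P1 ap2
  ...   | vanishes = Apply-zero ap3
  ...   | moves _ _ _ P2 mv2 with apply-view n≥1 P2 ap3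
  ...     | vanishes = refl
  ...     | moves _ _ _ _ mv3 with BeadMove.from-μ mv2 _ (BeadMove.src∈ mv3)
  ...       | inj₁ e        = ⊥-elim (dst+n≢src n i n≥1 (sym e))
  ...       | inj₂ (s∈ , _) = ⊥-elim (src∉ n≥1 mv1 s∈)

  Commutes-Apply : ∀ {n i j d} → 1 ≤ n → Commutes n i j d → ∀ {w y1 z1 y2 z2} → Valid w →
    Apply n j w y1 → Apply n i y1 z1 → Apply n i w y2 → Apply n j y2 z2 → z1 ≡ scale d z2
  Commutes-Apply n≥1 c g app0 app0 app0 app0 = refl
  Commutes-Apply {n} {i} {j} {d} n≥1 c g (appj {e = e} {x = x1} u1) ap1 (appj {x = x2} u2) ap2 = begin
    _                            ≡⟨ Apply-scale e n≥1 ap1 (proj₂ A1) refl (U-valid u1) ⟩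
    scale e (proj₁ A1)           ≡⟨ cong (scale e) (Commutes.commute c g u1 (proj₂ A1) u2 (proj₂ A2)) ⟩
    scale e (scale d (proj₁ A2)) ≡⟨ scale-+ e d _ ⟩
    scale (e +ᶻ d) (proj₁ A2)    ≡⟨ cong (λ z → scale z (proj₁ A2)) (ℤP.+-comm e d) ⟩
    scale (d +ᶻ e) (proj₁ A2)    ≡⟨ sym (scale-+ d e _) ⟩
    scale d (scale e (proj₁ A2)) ≡⟨ cong (scale d) (sym (Apply-scale e n≥1 ap2 (proj₂ A2) refl (U-valid u2))) ⟩
    _                            ∎
    where
    open ≡-Reasoning
    A1 : Σ Res (Apply n i x1)
    A1 = Apply-total n i x1 n≥1 (U-valid u1)
    A2 : Σ Res (Apply n j x2)
    A2 = Apply-total n j x2 n≥1 (U-valid u2)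

  Denotes : ℕ → List ℕ → Mon → Res → Set
  Denotes n l zeroM    y = y ≡ nothing
  Denotes n l (sc e w) y = Σ Res (λ z → Act n w (just (+ 0 , l)) z × y ≡ scale e z)

  Denotes-total : ∀ {n l} → 1 ≤ n → IsPartition l → ∀ m → Σ Res (Denotes n l m)
  Denotes-total n≥1 Pl zeroM = nothing , refl
  Denotes-total {n} {l} n≥1 Pl (sc e w) with Act-total n w (just (+ 0 , l)) n≥1 Pl
  ... | z , a = scale e z , z , a , refl

  Denotes-functional : ∀ {n l} → 1 ≤ n → IsPartition l → ∀ m {y y′} → Denotes n l m y → Denotes n l m y′ → y ≡ y′
  Denotes-functional n≥1 Pl zeroM p q = trans p (sym q)
  Denotes-functional n≥1 Pl (sc e w) (z , a , refl) (z′ , a′ , refl) =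
    cong (scale e) (trans (Act-scale (+ 0) n≥1 a a′ (sym (scale-0 _)) Pl) (scale-0 z′))

  in-context : ∀ {n} p p′ d → 1 ≤ n → (∀ {w y y′} → Valid w → Act n p w y → Act n p′ w y′ → y ≡ scale d y′) →
    ∀ e e′ a b {l} → IsPartition l → e +ᶻ d ≡ e′ → ∀ {Y Y′} →
    Denotes n l (sc e (a ++ p ++ b)) Y → Denotes n l (sc e′ (a ++ p′ ++ b)) Y′ → Y ≡ Y′
  in-context {n} p p′ d n≥1 rule e e′ a b {l} Pl e+d≡e′ (z , act , refl) (z′ , act′ , refl)
    with Act-++ a (p ++ b) act | Act-++ a (p′ ++ b) act′
  ... | u , pb , au | u′ , p′b , au′ with Act-++ p b pb | Act-++ p′ b p′b
  ...   | w , bw , pw | w′ , bw′ , pw′ = begin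
    scale e z            ≡⟨ cong (scale e) (Act-scale d n≥1 au au′ u≡ (Act-valid w′-valid pw′)) ⟩
    scale e (scale d z′) ≡⟨ scale-+ e d z′ ⟩
    scale (e +ᶻ d) z′    ≡⟨ cong (λ q → scale q z′) e+d≡e′ ⟩
    scale e′ z′          ∎
    where
    open ≡-Reasoning
    w≡ : w ≡ w′
    w≡ = trans (Act-scale (+ 0) n≥1 bw bw′ (sym (scale-0 _)) Pl) (scale-0 w′)
    w′-valid : Valid w′
    w′-valid = Act-valid {x = just (+ 0 , l)} Pl bw′
    u≡ : u ≡ scale d u′
    u≡ = rule w′-valid (subst (λ q → Act n p q u) w≡ pw) pw′

  in-context-zero : ∀ {n} p → (∀ {w y} → Valid w → Act n p w y → y ≡ nothing) →
    ∀ e a b {l} → IsPartition l → ∀ {Y} → Denotes n l (sc e (a ++ p ++ b)) Y → Y ≡ nothing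
  in-context-zero {n} p rule e a b {l} Pl (z , act , refl) with Act-++ a (p ++ b) act
  ... | u , pb , au with Act-++ p b pb
  ...   | w , bw , pw rewrite rule (Act-valid {x = just (+ 0 , l)} Pl bw) pw | Act-zero au = refl

  act-commutes : ∀ {n i j d} → 1 ≤ n → Commutes n i j d → ∀ {w y y′} → Valid w →
                 Act n (i ∷ j ∷ []) w y → Act n (j ∷ i ∷ []) w y′ → y ≡ scale d y′
  act-commutes n≥1 c g (cons (cons nil apj) api) (cons (cons nil api′) apj′) = Commutes-Apply n≥1 c g apj api api′ apj′

  act-R2 : ∀ {n i} → 1 ≤ n → ∀ {w y} → Valid w → Act n (i ∷ i ∷ []) w y → y ≡ nothing
  act-R2 n≥1 g (cons (cons nil ap1) ap2) = R2-holds n≥1 g ap1 ap2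

  act-R3 : ∀ {n i} → 1 ≤ n → ∀ {w y} → Valid w → Act n ((i +ᶻ + n) ∷ i ∷ (i +ᶻ + n) ∷ []) w y → y ≡ nothing
  act-R3 n≥1 g (cons (cons (cons nil ap1) ap2) ap3) = R3-holds n≥1 g ap1 ap2 ap3

  act-R4 : ∀ {n i} → 1 ≤ n → ∀ {w y} → Valid w → Act n (i ∷ (i +ᶻ + n) ∷ i ∷ []) w y → y ≡ nothing
  act-R4 n≥1 g (cons (cons (cons nil ap1) ap2) ap3) = R4-holds n≥1 g ap1 ap2 ap3

  Commutes-sym : ∀ {n i j} → Commutes n j i (+ 0) → Commutes n i j (+ 0)
  Commutes-sym c = record { commute = λ Pl u1 ap1 u2 ap2 →
    trans (sym (trans (Commutes.commute c Pl u2 ap2 u1 ap1) (scale-0 _))) (sym (scale-0 _)) }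

  sub≡⇒ : ∀ i j k → i -ᶻ j ≡ + k → i ≡ j +ᶻ + k
  sub≡⇒ i j k e = trans (solve 2 (λ I J → I := J :+ (I :- J)) refl i j) (cong (λ z → j +ᶻ z) e)
    where open ℤ-Solver

  sub-neg : ∀ i j m → i -ᶻ j ≡ -[1+ m ] → j -ᶻ i ≡ + suc m
  sub-neg i j m e = trans (solve 2 (λ I J → J :- I := :- (I :- J)) refl i j) (cong -_ e)
    where open ℤ-Solver

  commutes-R5 : ∀ n → 1 ≤ n → ∀ i j → + 0 <ᶻ i -ᶻ j → i -ᶻ j <ᶻ + n → Commutes n i j (+ 2)
  commutes-R5 n n≥1 i j 0<i-j i-j<n with i -ᶻ j in eq
  ... | + k = subst (λ z → Commutes n z j (+ 2)) (sym (sub≡⇒ i j k eq))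
    (CommuteAt.commutes-near n n≥1 j k (ℤP.drop‿+<+ 0<i-j) (λ e → ℕP.<-irrefl e (ℤP.drop‿+<+ i-j<n)) (ℤP.drop‿+<+ i-j<n))

  commutes-far⁺ : ∀ n → 1 ≤ n → ∀ i j k → i -ᶻ j ≡ + k → suc n ≤ k → Commutes n i j (+ 0)
  commutes-far⁺ n n≥1 i j k eq le = subst (λ z → Commutes n z j (+ 0)) (sym (sub≡⇒ i j k eq))
    (CommuteAt.commutes-far n n≥1 j k (ℕP.≤-trans (s≤s z≤n) le) (λ e → ℕP.<-irrefl (sym e) le)
                            (λ lt → ℕP.<-irrefl refl (ℕP.<-trans lt le)))

  commutes-R1 : ∀ n → 1 ≤ n → ∀ i j → suc n ≤ ∣ i -ᶻ j ∣ → Commutes n i j (+ 0)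
  commutes-R1 n n≥1 i j le with i -ᶻ j in eq
  ... | + k      = commutes-far⁺ n n≥1 i j k eq le
  ... | -[1+ m ] = Commutes-sym (commutes-far⁺ n n≥1 j i (suc m) (sub-neg i j m eq) le)

  Deriv-sound : ∀ {n m m′} → 1 ≤ n → Deriv n m m′ → ∀ {l} → IsPartition l → ∀ {y y′} →
                Denotes n l m y → Denotes n l m′ y′ → y ≡ y′
  Deriv-sound n≥1 (drefl {x = m}) Pl p q = Denotes-functional n≥1 Pl m p q
  Deriv-sound n≥1 (dsym d) Pl p q = sym (Deriv-sound n≥1 d Pl q p)
  Deriv-sound n≥1 (dtrans {y = m} d1 d2) Pl p q with Denotes-total n≥1 Pl m
  ... | _ , r = trans (Deriv-sound n≥1 d1 Pl p r) (Deriv-sound n≥1 d2 Pl r q)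
  Deriv-sound {n} n≥1 (r1 e a b i j le) Pl p q =
    in-context (i ∷ j ∷ []) (j ∷ i ∷ []) (+ 0) n≥1 (act-commutes n≥1 (commutes-R1 n n≥1 i j le)) e e a b Pl (ℤP.+-identityʳ e) p q
  Deriv-sound {n} n≥1 (r2 e a b i) Pl p q =
    trans (in-context-zero (i ∷ i ∷ []) (act-R2 n≥1) e a b Pl p) (sym q)
  Deriv-sound {n} n≥1 (r3 e a b i) Pl p q =
    trans (in-context-zero ((i +ᶻ + n) ∷ i ∷ (i +ᶻ + n) ∷ []) (act-R3 n≥1) e a b Pl p) (sym q)
  Deriv-sound {n} n≥1 (r4 e a b i) Pl p q =
    trans (in-context-zero (i ∷ (i +ᶻ + n) ∷ i ∷ []) (act-R4 n≥1) e a b Pl p) (sym q)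
  Deriv-sound {n} n≥1 (r5 e a b i j lt1 lt2) Pl p q =
    in-context (i ∷ j ∷ []) (j ∷ i ∷ []) (+ 2) n≥1 (act-commutes n≥1 (commutes-R5 n n≥1 i j lt1 lt2)) e (e +ᶻ + 2) a b Pl refl p q

  Deriv⇒OpEq : ∀ {n I t J} → 1 ≤ n → Deriv n (sc (+ 0) I) (sc t J) → OpEq n I t J
  Deriv⇒OpEq n≥1 d l Pl x y ax ay = trans (sym (scale-0 x)) (Deriv-sound n≥1 d Pl (x , ax , refl) (y , ay , refl))

  onRunner : ℕ → ℤ → ℕ
  onRunner n (+ d)    = indicator (n ∣? d)
  onRunner n -[1+ _ ] = 0

  onRunner-neg : ∀ n y → y <ᶻ + 0 → onRunner n y ≡ 0
  onRunner-neg n (+ _)     (ℤ.+<+ ())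
  onRunner-neg n -[1+ _ ] _ = refl

  onRunner-step : ∀ n d → d ≢ + 0 → onRunner n (d -ᶻ + n) ≡ onRunner n d
  onRunner-step n -[1+ m ] _ rewrite ℤP.neg-minus-pos m n = refl
  onRunner-step n (+ zero) d≢0 = ⊥-elim (d≢0 refl)
  onRunner-step n (+ suc k) _ with suc k <? n
  ... | yes k<n = trans (onRunner-neg n _ (sub<sub⇐ (suc k) n 0 0 (subst (_< n) (sym (ℕP.+-identityʳ (suc k))) k<n)))
                        (sym (indicator-no (n ∣? suc k) (λ n∣k → ℕP.<⇒≱ k<n (∣⇒≤ n∣k))))
  ... | no k≮n = trans (cong (onRunner n) diff) (indicator-⇔ (n ∣? (suc k ∸ n)) (n ∣? suc k) ⇒ ⇐)
    where
    n≤k : n ≤ suc k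
    n≤k = ℕP.≮⇒≥ k≮n
    diff : + suc k -ᶻ + n ≡ + (suc k ∸ n)
    diff = trans (sub≡sub⇐ (suc k) n (suc k ∸ n) 0 (trans (ℕP.+-identityʳ _) (sym (ℕP.m∸n+n≡m n≤k)))) (ℤP.+-identityʳ _)
    ⇒ : n ∣ suc k ∸ n → n ∣ suc k
    ⇒ p = ∣m∸n∣n⇒∣m n n≤k p n∣n
    ⇐ : n ∣ suc k → n ∣ suc k ∸ n
    ⇐ p = ∣m+n∣m⇒∣n (subst (n ∣_) (sym (ℕP.m+[n∸m]≡n n≤k)) p) n∣n

  weight : ℕ → ℤ → ℤ → ℕ
  weight n a x = onRunner n (x -ᶻ dst a)

  weight-below : ∀ n a x → x <ᶻ dst a → weight n a x ≡ 0
  weight-below n a x lt =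
    onRunner-neg n _ (subst (x -ᶻ dst a <ᶻ_) (ℤP.+-inverseʳ (dst a)) (ℤP.+-monoˡ-< (- dst a) lt))

  weight-own-dst : ∀ n a → weight n a (dst a) ≡ 1
  weight-own-dst n a rewrite ℤP.+-inverseʳ (dst a) = indicator-yes (n ∣? 0) (n ∣0)

  weight-own-src : ∀ n a → 1 ≤ n → weight n a (src n a) ≡ 0
  weight-own-src n a n≥1 = onRunner-neg n _ (subst (_<ᶻ + 0) (sym src-dst) (sub<sub⇐ 0 n 0 0 n≥1))
    where
    src-dst : src n a -ᶻ dst a ≡ + 0 -ᶻ + n
    src-dst = solve 2 (λ A N → A :+ con (+ 1) :- N :- (A :+ con (+ 1)) := con (+ 0) :- N) refl a (+ n)
      where open ℤ-Solver

  -- A move u_c with c ≠ a keeps its bead on the same runner and on the same side of dst a.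
  weight-other : ∀ n a c → c ≢ a → weight n a (src n c) ≡ weight n a (dst c)
  weight-other n a c c≢a = trans (cong (onRunner n) src-dst) (onRunner-step n _ dd≢0)
    where
    open ℤ-Solver
    src-dst : src n c -ᶻ dst a ≡ (dst c -ᶻ dst a) -ᶻ + n
    src-dst = solve 3 (λ C A N → C :+ con (+ 1) :- N :- (A :+ con (+ 1)) := C :+ con (+ 1) :- (A :+ con (+ 1)) :- N) refl c a (+ n)
    dd≢0 : dst c -ᶻ dst a ≢ + 0
    dd≢0 e = c≢a (trans (solve 2 (λ C A → C := C :+ con (+ 1) :- (A :+ con (+ 1)) :+ A) refl c a)
                        (trans (cong (_+ᶻ a) e) (ℤP.+-identityˡ a)))

  Act-last : ∀ {n a w e e′ μ ν} → 1 ≤ n → IsPartition μ → Act n (a ∷ w) (just (e , μ)) (just (e′ , ν)) →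
             Σ ℤ (λ e″ → Σ (List ℕ) (λ ρ → Act n w (just (e , μ)) (just (e″ , ρ)) × IsPartition ρ × BeadMove n a ρ ν))
  Act-last n≥1 Pμ (cons act ap) with Act-valid {x = just (_ , _)} Pμ act
  ... | Pρ with apply-view n≥1 Pρ ap
  ...   | moves e″ ρ _ _ mv = e″ , ρ , act , Pρ , mv

  <dst : ∀ a → a <ᶻ dst a
  <dst a = subst (_<ᶻ dst a) (ℤP.+-identityʳ a) (ℤP.+-monoʳ-< a (ℤ.+<+ (s≤s z≤n)))

  -- The potential of λ with respect to a is the number of beads of λ at the positions
  -- dst a, dst a + n, dst a + 2n, …: u_a raises it by one and every other u_c preserves it.
  record Potential (n : ℕ) (a : ℤ) (l : List ℕ) (k : ℕ) : Set where
    constructor potential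
    field
      bound : ℕ
      sum≡  : ∀ R → bound ≤ R → sumβ (weight n a) l R ≡ k

  potential-exists : ∀ n a {l} → IsPartition l → Σ ℕ (Potential n a l)
  potential-exists n a {l} P with β-eventually-≤ P a
  ... | N , β≤a = sumβ (weight n a) l N , potential N λ R N≤R → sumTo-stable (λ r → weight n a (β l r)) N R N≤R
    (λ r N≤r _ → weight-below n a (β l r) (ℤP.≤-<-trans (ℤP.≤-trans (β-nonincreasing P N≤r) β≤a) (<dst a)))

  potential-unique : ∀ {n a l k k′} → Potential n a l k → Potential n a l k′ → k ≡ k′
  potential-unique (potential N p) (potential N′ q) = trans (sym (p (N + N′) (ℕP.m≤m+n N N′))) (q (N + N′) (ℕP.m≤n+m N′ N))

  potential-move : ∀ {n a c l m k k′} → BeadMove n c l m → Potential n a l k → Potential n a m k′ →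
                   k′ + weight n a (src n c) ≡ k + weight n a (dst c)
  potential-move {n} {a} {c} mv (potential N p) (potential N′ q) =
    trans (cong (_+ weight n a (src n c)) (sym (q R N′≤R)))
          (trans (BeadMove.sumβ-move mv (weight n a) R mv≤R) (cong (_+ weight n a (dst c)) (p R N≤R)))
    where
    R : ℕ
    R = N + N′ + BeadMove.bound mv
    N≤R : N ≤ R
    N≤R = ℕP.≤-trans (ℕP.m≤m+n N N′) (ℕP.m≤m+n _ _)
    N′≤R : N′ ≤ R
    N′≤R = ℕP.≤-trans (ℕP.m≤n+m N′ N) (ℕP.m≤m+n _ _)
    mv≤R : BeadMove.bound mv ≤ R
    mv≤R = ℕP.m≤n+m _ _

  potential-other : ∀ {n a c l m k k′} → c ≢ a → BeadMove n c l m → Potential n a l k → Potential n a m k′ → k′ ≡ k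
  potential-other {n} {a} {c} {k = k} c≢a mv p q =
    ℕP.+-cancelʳ-≡ _ _ _ (trans (potential-move mv p q) (cong (_+_ k) (sym (weight-other n a c c≢a))))

  potential-own : ∀ {n a l m k k′} → 1 ≤ n → BeadMove n a l m → Potential n a l k → Potential n a m k′ → k′ ≡ suc k
  potential-own {n} {a} {k = k} {k′} n≥1 mv p q = begin
    k′                         ≡⟨ sym (ℕP.+-identityʳ k′) ⟩
    k′ + 0                     ≡⟨ cong (_+_ k′) (sym (weight-own-src n a n≥1)) ⟩
    k′ + weight n a (src n a)  ≡⟨ potential-move mv p q ⟩
    k + weight n a (dst a)     ≡⟨ cong (_+_ k) (weight-own-dst n a) ⟩
    k + 1                      ≡⟨ ℕP.+-comm k 1 ⟩
    suc k                      ∎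
    where open ≡-Reasoning

  potential-mono : ∀ {n a c l m k k′} → 1 ≤ n → BeadMove n c l m → Potential n a l k → Potential n a m k′ → k ≤ k′
  potential-mono {a = a} {c} n≥1 mv p q with c ℤ.≟ a
  ... | yes refl = ℕP.≤-trans (ℕP.n≤1+n _) (ℕP.≤-reflexive (sym (potential-own n≥1 mv p q)))
  ... | no c≢a   = ℕP.≤-reflexive (sym (potential-other c≢a mv p q))

  potential-Act : ∀ {n a w e e′ μ ν} → 1 ≤ n → IsPartition μ → Act n w (just (e , μ)) (just (e′ , ν)) →
                  ∀ {k k′} → Potential n a μ k → Potential n a ν k′ → k ≤ k′
  potential-Act n≥1 Pμ nil p q = ℕP.≤-reflexive (potential-unique p q)
  potential-Act {n} {a} n≥1 Pμ act@(cons _ _) p q with Act-last n≥1 Pμ act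
  ... | _ , _ , act′ , Pρ , mv with potential-exists n a Pρ
  ...   | _ , pρ = ℕP.≤-trans (potential-Act n≥1 Pμ act′ p pρ) (potential-mono n≥1 mv pρ q)

  potential-Act-own : ∀ {n a w e e′ μ ν} → 1 ≤ n → IsPartition μ → Act n (a ∷ w) (just (e , μ)) (just (e′ , ν)) →
                      ∀ {k k′} → Potential n a μ k → Potential n a ν k′ → k < k′
  potential-Act-own {n} {a} n≥1 Pμ act p q with Act-last n≥1 Pμ act
  ... | _ , _ , act′ , Pρ , mv with potential-exists n a Pρ
  ...   | _ , pρ = ℕP.≤-trans (s≤s (potential-Act n≥1 Pμ act′ p pρ)) (ℕP.≤-reflexive (sym (potential-own n≥1 mv pρ q)))

  cons-mon : ℤ → Mon → Mon
  cons-mon a zeroM    = zeroM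
  cons-mon a (sc e w) = sc e (a ∷ w)

  Deriv-cons : ∀ {n m m′} a → Deriv n m m′ → Deriv n (cons-mon a m) (cons-mon a m′)
  Deriv-cons a drefl                = drefl
  Deriv-cons a (dsym d)             = dsym (Deriv-cons a d)
  Deriv-cons a (dtrans d d′)        = dtrans (Deriv-cons a d) (Deriv-cons a d′)
  Deriv-cons a (r1 e a′ b i j h)    = r1 e (a ∷ a′) b i j h
  Deriv-cons a (r2 e a′ b i)        = r2 e (a ∷ a′) b i
  Deriv-cons a (r3 e a′ b i)        = r3 e (a ∷ a′) b i
  Deriv-cons a (r4 e a′ b i)        = r4 e (a ∷ a′) b i
  Deriv-cons a (r5 e a′ b i j h h′) = r5 e (a ∷ a′) b i j h h′

  rescale : ℤ → Mon → Mon
  rescale d zeroM    = zeroM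
  rescale d (sc e w) = sc (d +ᶻ e) w

  Deriv-rescale : ∀ {n m m′} d → Deriv n m m′ → Deriv n (rescale d m) (rescale d m′)
  Deriv-rescale d drefl            = drefl
  Deriv-rescale d (dsym x)         = dsym (Deriv-rescale d x)
  Deriv-rescale d (dtrans x y)     = dtrans (Deriv-rescale d x) (Deriv-rescale d y)
  Deriv-rescale d (r1 e a b i j h) = r1 (d +ᶻ e) a b i j h
  Deriv-rescale d (r2 e a b i)     = r2 (d +ᶻ e) a b i
  Deriv-rescale d (r3 e a b i)     = r3 (d +ᶻ e) a b i
  Deriv-rescale d (r4 e a b i)     = r4 (d +ᶻ e) a b i
  Deriv-rescale {n} d (r5 e a b i j h h′) =
    subst (λ z → Deriv n (sc (d +ᶻ e) (a ++ i ∷ j ∷ b)) (sc z (a ++ j ∷ i ∷ b))) (ℤP.+-assoc d e (+ 2)) (r5 (d +ᶻ e) a b i j h h′)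

  -- u_c can be moved past u_a by (R1) or (R5).
  Far : ℕ → ℤ → ℤ → Set
  Far n a c = (c ≢ a) × (c ≢ a +ᶻ + n) × (a ≢ c +ᶻ + n)

  swap-far : ∀ {n a c} → Far n a c → ∀ e T → Σ ℤ (λ e′ → Deriv n (sc e (c ∷ a ∷ T)) (sc e′ (a ∷ c ∷ T)))
  swap-far {n} {a} {c} (c≢a , c≢a+n , a≢c+n) e T with c -ᶻ a in eq
  ... | + zero = ⊥-elim (c≢a (trans (sub≡⇒ c a 0 eq) (ℤP.+-identityʳ a)))
  ... | + suc k with ℕP.<-cmp (suc k) n
  ...   | tri< lt _ _ = e +ᶻ + 2 , r5 e [] T c a (subst (+ 0 <ᶻ_) (sym eq) (ℤ.+<+ (s≤s z≤n))) (subst (_<ᶻ + n) (sym eq) (ℤ.+<+ lt))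
  ...   | tri≈ _ refl _ = ⊥-elim (c≢a+n (sub≡⇒ c a (suc k) eq))
  ...   | tri> _ _ gt = e , r1 e [] T c a (subst (λ z → suc n ≤ ∣ z ∣) (sym eq) gt)
  swap-far {n} {a} {c} (c≢a , c≢a+n , a≢c+n) e T | -[1+ m ] with ℕP.<-cmp (suc m) n
  ...   | tri< lt _ _ = e -ᶻ + 2 , dsym (subst (λ z → Deriv n (sc (e -ᶻ + 2) (a ∷ c ∷ T)) (sc z (c ∷ a ∷ T)))
                                             (solve 1 (λ E → E :- con (+ 2) :+ con (+ 2) := E) refl e)
                                             (r5 (e -ᶻ + 2) [] T a c (subst (+ 0 <ᶻ_) (sym a-c) (ℤ.+<+ (s≤s z≤n)))
                                                                     (subst (_<ᶻ + n) (sym a-c) (ℤ.+<+ lt))))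
    where
    open ℤ-Solver
    a-c : a -ᶻ c ≡ + suc m
    a-c = sub-neg c a m eq
  ...   | tri≈ _ refl _ = ⊥-elim (a≢c+n (sub≡⇒ a c (suc m) (sub-neg c a m eq)))
  ...   | tri> _ _ gt = e , r1 e [] T c a (subst (λ z → suc n ≤ ∣ z ∣) (sym eq) gt)

  move-to-front : ∀ {n a} P S → All (Far n a) P → Σ ℤ (λ e → Deriv n (sc (+ 0) (P ++ a ∷ S)) (sc e (a ∷ P ++ S)))
  move-to-front []      S []       = + 0 , drefl
  move-to-front (c ∷ P) S (f ∷ fs) with move-to-front P S fs
  ... | e′ , d′ with swap-far f e′ (P ++ S)
  ...   | e″ , d″ = e″ , dtrans (Deriv-cons c d′) d″

  src-shift : ∀ n x → src n (x +ᶻ + n) ≡ dst x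
  src-shift n x = solve 2 (λ X N → X :+ N :+ con (+ 1) :- N := X :+ con (+ 1)) refl x (+ n)
    where open ℤ-Solver

  dst-injective : ∀ {x y} → dst x ≡ dst y → x ≡ y
  dst-injective {x} {y} e = trans (solve 1 (λ X → X := X :+ con (+ 1) :- con (+ 1)) refl x)
    (trans (cong (_-ᶻ + 1) e) (solve 1 (λ X → X :+ con (+ 1) :- con (+ 1) := X) refl y))
    where open ℤ-Solver

  src-injective : ∀ {n x y} → src n x ≡ src n y → x ≡ y
  src-injective {n} {x} {y} e = trans (solve 2 (λ X N → X := X :+ con (+ 1) :- N :+ N :- con (+ 1)) refl x (+ n))
    (trans (cong (λ z → z +ᶻ + n -ᶻ + 1) e) (solve 2 (λ X N → X :+ con (+ 1) :- N :+ N :- con (+ 1) := X) refl y (+ n)))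
    where open ℤ-Solver

  dst≢dst+n : ∀ n x → 1 ≤ n → dst x ≢ dst (x +ᶻ + n)
  dst≢dst+n n x n≥1 e = offset-≢ x 1 0 (1 + n) 0 (λ q → ℕP.<-irrefl (trans (ℕP.suc-injective q) (ℕP.+-identityʳ n)) n≥1)
                                  (trans (sym (dst-offset₀ x)) (trans e (dst-offset x n)))

  -- Scanning J from the left (the moves applied last): while the potential of a still has to
  -- drop, each letter c ≠ a keeps dst a occupied and src a empty, which forces c to be Far from a.
  first-occurrence : ∀ {n} → 1 ≤ n → ∀ a J {μ ν e e′} → IsPartition μ → Act n J (just (e , μ)) (just (e′ , ν)) →
    dst a ∈β ν → ¬ (src n a ∈β ν) → ∀ {k k′} → Potential n a μ k → Potential n a ν k′ → k < k′ →
    Σ (List ℤ) (λ P → Σ (List ℤ) (λ S → (J ≡ P ++ a ∷ S) × All (Far n a) P))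
  first-occurrence n≥1 a [] Pμ nil dst∈ src∉ p q lt = ⊥-elim (ℕP.<-irrefl (potential-unique p q) lt)
  first-occurrence {n} n≥1 a (c ∷ J) {ν = ν} Pμ act dst∈ src∉ p q lt with Act-last n≥1 Pμ act
  ... | _ , ρ , act′ , Pρ , mv with c ℤ.≟ a
  ...   | yes refl = [] , J , refl , []
  ...   | no c≢a with c ℤ.≟ a +ᶻ + n
  ...     | yes refl = ⊥-elim (dst-vacated (BeadMove.from-μ mv _ dst∈))
    where
    dst-vacated : ¬ (dst a ≡ dst (a +ᶻ + n) ⊎ (dst a ∈β ρ × dst a ≢ src n (a +ᶻ + n)))
    dst-vacated (inj₁ e)        = dst≢dst+n n a n≥1 e
    dst-vacated (inj₂ (_ , ne)) = ne (sym (src-shift n a))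
  ...     | no c≢a+n with a ℤ.≟ c +ᶻ + n
  ...       | yes refl = ⊥-elim (src∉ (subst (_∈β ν) (sym (src-shift n c)) (BeadMove.dst∈ mv)))
  ...       | no a≢c+n with potential-exists n a Pρ
  ...         | _ , pρ with first-occurrence n≥1 a J Pμ act′ dst∈ρ src∉ρ p pρ (subst (_ <_) (potential-other c≢a mv pρ q) lt)
    where
    dst∈ρ : dst a ∈β ρ
    dst∈ρ with BeadMove.from-μ mv _ dst∈
    ... | inj₁ e       = ⊥-elim (c≢a (sym (dst-injective e)))
    ... | inj₂ (d∈ , _) = d∈
    src∉ρ : ¬ (src n a ∈β ρ)
    src∉ρ s∈ = src∉ (BeadMove.from-λ mv _ s∈ (λ e → c≢a (sym (src-injective e))))
  ...           | P , S , refl , far = c ∷ P , S , refl , ((c≢a , c≢a+n , a≢c+n) ∷ far)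

  scale-just : ∀ {e e′ ν} z → just (e′ , ν) ≡ scale e z → Σ ℤ (λ f → z ≡ just (f , ν))
  scale-just nothing        ()
  scale-just (just (f , l)) refl = f , refl

  -- Induction on I: its last move u_a must also be J's last move up to far letters, which can be
  -- commuted to the front; injectivity of u_a identifies the partitions before it.
  derivable : ∀ {n} → 1 ≤ n → ∀ I J {μ ν e1 e2} → IsPartition μ →
    Act n I (just (+ 0 , μ)) (just (e1 , ν)) → Act n J (just (+ 0 , μ)) (just (e2 , ν)) →
    Σ ℤ (λ e → Deriv n (sc (+ 0) I) (sc e J))
  derivable n≥1 [] [] Pμ nil nil = + 0 , drefl
  derivable {n} n≥1 [] (c ∷ J) Pμ nil actJ with potential-exists n c Pμ
  ... | _ , p = ⊥-elim (ℕP.<-irrefl refl (potential-Act-own n≥1 Pμ actJ p p))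
  derivable {n} n≥1 (a ∷ I) J {μ} {e2 = e2} Pμ actI actJ with Act-last n≥1 Pμ actI
  ... | _ , ρ , actI′ , Pρ , mv with potential-exists n a Pμ | potential-exists n a Pρ | potential-exists n a (Act-valid {x = just (_ , _)} Pμ actI)
  ...   | _ , pμ | _ , pρ | _ , pν
    with first-occurrence n≥1 a J Pμ actJ (BeadMove.dst∈ mv) (src∉ n≥1 mv) pμ pν
           (ℕP.≤-trans (s≤s (potential-Act n≥1 Pμ actI′ pμ pρ)) (ℕP.≤-reflexive (sym (potential-own n≥1 mv pρ pν))))
  ...     | P , S , refl , far with move-to-front P S far
  ...       | e′ , to-front with Act-total n (a ∷ P ++ S) (just (+ 0 , μ)) n≥1 Pμ
  ...         | z , act-front with scale-just z (Deriv-sound n≥1 to-front Pμ (_ , actJ , sym (scale-0 (just (e2 , _)))) (z , act-front , refl))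
  ...           | _ , refl with Act-last n≥1 Pμ act-front
  ...             | _ , ρ′ , act-PS , Pρ′ , mv′ with BeadMove-injective Pρ′ Pρ mv′ mv
  ...               | refl with derivable n≥1 I (P ++ S) Pμ actI′ act-PS
  ...                 | e , IPS = e -ᶻ e′ , dtrans (Deriv-cons a IPS) (dsym back)
    where
    open ℤ-Solver
    back : Deriv n (sc (e -ᶻ e′) (P ++ a ∷ S)) (sc e (a ∷ P ++ S))
    back = subst₂ (λ x y → Deriv n (sc x (P ++ a ∷ S)) (sc y (a ∷ P ++ S)))
                  (ℤP.+-identityʳ (e -ᶻ e′)) (solve 2 (λ E E′ → E :- E′ :+ E′ := E) refl e e′)
                  (Deriv-rescale (e -ᶻ e′) to-front)

  Deriv-exponent : ∀ {n I J e t b μ ν} → 1 ≤ n → IsPartition μ → Deriv n (sc (+ 0) I) (sc e J) →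
    Act n I (just (+ 0 , μ)) (just (t +ᶻ b , ν)) → Act n J (just (+ 0 , μ)) (just (b , ν)) → t ≡ e
  Deriv-exponent {e = e} {t} {b} {ν = ν} n≥1 Pμ I~J actI actJ = begin
    t            ≡⟨ solve 2 (λ T B → T := T :+ B :- B) refl t b ⟩
    t +ᶻ b -ᶻ b  ≡⟨ cong (_-ᶻ b) (cong proj₁ (just-injective images)) ⟩
    e +ᶻ b -ᶻ b  ≡⟨ solve 2 (λ E B → E :+ B :- B := E) refl e b ⟩
    e            ∎
    where
    open ≡-Reasoning
    open ℤ-Solver
    images : just (t +ᶻ b , ν) ≡ just (e +ᶻ b , ν)
    images = Deriv-sound n≥1 I~J Pμ (just (t +ᶻ b , ν) , actI , sym (scale-0 _)) (just (b , ν) , actJ , refl)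

open import Defs
open import Data.Nat using (ℕ; _≤_)
open import Data.Integer using (ℤ; +_; _+_)
open import Data.List using (List)
open import Data.Maybe using (just)
open import Data.Product using (_×_; _,_; Σ)
open import Relation.Binary.PropositionalEquality using (subst; sym)

lemma3p2 : (n : ℕ) → 1 ≤ n → (I J : List ℤ) (t : ℤ) (μ : List ℕ) → IsPartition μ →
    Σ ℤ (λ b → Σ (List ℕ) (λ ν →
    Act n I (just (+ 0 , μ)) (just (t + b , ν)) × Act n J (just (+ 0 , μ)) (just (b , ν)))) →
    OpEq n I t J × Deriv n (sc (+ 0) I) (sc t J)
lemma3p2 n n≥1 I J t μ Pμ (b , ν , actI , actJ) with derivable n≥1 I J Pμ actI actJ
... | e , I~eJ = Deriv⇒OpEq n≥1 I~tJ , I~tJ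
  where
  I~tJ : Deriv n (sc (+ 0) I) (sc t J)
  I~tJ = subst (λ z → Deriv n (sc (+ 0) I) (sc z J)) (sym (Deriv-exponent n≥1 Pμ I~eJ actI actJ)) I~eJ
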